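{- Let $(p_n(x))_{n\ge-1}$ and $(q_n(x))_{n\ge-1}$ be the polynomials defined by $p_{ -1}(x)=0$, $q_{ -1}(x)=1$ and, for $k\ge -1$, $$p_{k+1}(x)=2(kx+1)p_k(x)+2x(1-x)p_k'(x)+q_k(x),\qquad q_{k+1}(x)=\bigl(2(k+1)x+1\bigr)q_k(x)+2x(1-x)q_k'(x).$$ Then for every $n\ge0$, $$\left(\frac23\right)^np_n\!\left(\frac14\right)=\sum_{k=0}^nB_{n-k}^{(-k)}.$$
   Context: For an integer $k$, $\mathrm{Li}_k(z)=\sum_{m\ge1}z^m/m^k$. The poly-Bernoulli numbers $B_n^{(k)}\in\mathbb Q$ are defined by $\sum_{n\ge0}B_n^{(k)}\frac{t^n}{n!}=\frac{\mathrm{Li}_k(1-e^{ -t})}{1-e^{ -t}}$. -}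

module Defs where

open import Data.Nat as ℕ using (ℕ; zero; suc; _!)
open import Data.Nat.Properties using (_!≢0)
open import Data.Integer as ℤ using (ℤ; +_; -[1+_])
open import Data.Rational as ℚ using (ℚ; _/_)
open import Data.List using (List; []; _∷_)
open import Data.Product using (_×_; _,_; proj₁; proj₂)

Σ≤ : ℕ → (ℕ → ℚ) → ℚ
Σ≤ zero    f = f 0
Σ≤ (suc n) f = Σ≤ n f ℚ.+ f (suc n)

-- Polynomials with integer coefficients (lowest degree first)

Poly : Set
Poly = List ℤ

infixl 6 _⊕_
_⊕_ : Poly → Poly → Poly
[]      ⊕ q       = q
(a ∷ p) ⊕ []      = a ∷ p
(a ∷ p) ⊕ (b ∷ q) = (a ℤ.+ b) ∷ (p ⊕ q)

scale : ℤ → Poly → Poly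
scale c []      = []
scale c (a ∷ p) = (c ℤ.* a) ∷ scale c p

mulX : Poly → Poly
mulX p = + 0 ∷ p

derivFrom : ℕ → Poly → Poly
derivFrom i []      = []
derivFrom i (a ∷ p) = (+ i ℤ.* a) ∷ derivFrom (suc i) p

deriv : Poly → Poly
deriv []      = []
deriv (a ∷ p) = derivFrom 1 p

mulX1-X : Poly → Poly
mulX1-X f = mulX f ⊕ scale -[1+ 0 ] (mulX (mulX f))

eval : Poly → ℚ → ℚ
eval []      x = ℚ.0ℚ
eval (a ∷ p) x = (a / 1) ℚ.+ x ℚ.* eval p x

-- The sequences p_n, q_n for n ≥ -1, shifted by one:
-- pq m = (p_{m-1}, q_{m-1}).  With k = m - 1:
--   p_{k+1} = 2(kx+1) p_k + 2x(1-x) p_k' + q_k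
--   q_{k+1} = (2(k+1)x+1) q_k + 2x(1-x) q_k'

pq : ℕ → Poly × Poly
pq zero = [] , (+ 1 ∷ [])
pq (suc m) =
  let p = proj₁ (pq m)
      q = proj₂ (pq m)
      k : ℤ
      k = + m ℤ.- + 1
  in  ( scale (+ 2) (scale k (mulX p) ⊕ p)
          ⊕ scale (+ 2) (mulX1-X (deriv p)) ⊕ q
      , (scale (+ 2 ℤ.* (k ℤ.+ + 1)) (mulX q) ⊕ q)
          ⊕ scale (+ 2) (mulX1-X (deriv q)) )

pPoly : ℕ → Poly
pPoly n = proj₁ (pq (suc n))

qPoly : ℕ → Poly
qPoly n = proj₂ (pq (suc n))

Series : Set
Series = ℕ → ℚ

_⊛_ : Series → Series → Series
(f ⊛ g) n = Σ≤ n (λ i → f i ℚ.* g (n ℕ.∸ i))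

one : Series
one zero    = ℚ.1ℚ
one (suc n) = ℚ.0ℚ

-- u(t) = 1 - e^{-t} = Σ_{n≥1} (-1)^{n+1} t^n / n!
u : Series
u zero    = ℚ.0ℚ
u (suc n) = (ℤ.-1ℤ ℤ.^ (suc (suc n))) / (suc n !)
  where instance _ = suc n !≢0

upow : ℕ → Series
upow zero    = one
upow (suc m) = upow m ⊛ u

-- Li_{-k}(z)/z = Σ_{m≥0} (m+1)^k z^m, so
--   Li_{-k}(1-e^{-t})/(1-e^{-t}) = Σ_{m≥0} (m+1)^k u(t)^m.
-- Since u(t)^m has order m, the coefficient of t^n only involves m ≤ n.
genCoeff : ℕ → ℕ → ℚ
genCoeff k n = Σ≤ n (λ m → ((+ (suc m ℕ.^ k)) / 1) ℚ.* upow m n)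

polyBernoulliNeg : ℕ → ℕ → ℚ
polyBernoulliNeg n k = ((+ (n !)) / 1) ℚ.* genCoeff k n

infixr 8 _^ℚ_
_^ℚ_ : ℚ → ℕ → ℚ
x ^ℚ zero  = ℚ.1ℚ
x ^ℚ suc n = x ℚ.* (x ^ℚ n)

-- Let A n be the right-hand side and u = 1 - e^{-t}. Since
-- Li_{-k}(u)/u = Σ_m (m+1)^k u^m, A n = Σ_m [z^n] W_m(z), where in an auxiliary
-- variable z the sequence n! [t^n] u^m has generating function
-- U_m = m! z^m / ∏_{j≤m} (1+jz), and W_m = U_m / (1-(m+1)z).  A telescoping
-- identity between these rational functions gives the recurrence
--   4 A_n - 2 A_{n-1} - Σ_i C(n,i) A_i = 3,
-- i.e. the exponential generating function Φ(t) = Σ_n A_{n-1} t^n/n! satisfies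
-- (1-x) Φ' = 3x + Φ/2 with x = e^t/4.  As x d/dx = d/dt, the recurrences for
-- p and q turn into  2 (3x p_{m-1} + q_{m-1} Φ/2) = 2^m (1-x)^m Φ^{(m)}.
-- At t = 0 we have x = 1/4 and Φ = 0, so (3/2) p_n(1/4) = (3/2)^{n+1} A_n.
module Submission where

open import Defs
open import Algebra.Bundles using (CommutativeMonoid; CommutativeRing)
import Algebra.Solver.Ring.AlmostCommutativeRing as ACR
open import Data.Integer as ℤ using (ℤ; +_; -[1+_])
import Data.Integer.Properties as ℤP
open import Data.Integer.Tactic.RingSolver using (solve-∀)
open import Data.List using ([]; _∷_)
open import Data.Maybe using (just; nothing)
open import Data.Nat as ℕ using (ℕ; zero; suc; s≤s; z≤n; _!)
import Data.Nat.Properties as ℕP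
open import Data.Nat.Properties using (_!≢0; _!*_!≢0)
open import Data.Nat.Combinatorics using (_C_; nCk≡n!/k![n-k]!; k![n∸k]!∣n!; nCk+nC[k+1]≡[n+1]C[k+1]; k>n⇒nCk≡0)
open import Data.Nat.DivMod using (m/n*n≡m)
open import Data.Product using (_,_; proj₁; proj₂)
open import Data.Rational as ℚ using (ℚ; _/_; 0ℚ; 1ℚ)
import Data.Rational.Properties as ℚP
open import Algebra.Properties.CommutativeSemigroup
  (CommutativeMonoid.commutativeSemigroup ℚP.*-1-commutativeMonoid)
  using (x∙yz≈y∙xz; xy∙z≈y∙xz; interchange)
open import Data.Rational.Solver using (module +-*-Solver)
open import Data.Rational.Unnormalised as ℚᵘ using (mkℚᵘ; *≡*)
import Data.Rational.Unnormalised.Properties as ℚᵘP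
open import Relation.Binary.Definitions using (WeaklyDecidable)
open import Relation.Binary.PropositionalEquality
open import Relation.Binary.Structures using (IsEquivalence)
import Relation.Binary.Reasoning.Setoid as SetoidReasoning
open import Relation.Nullary using (yes; no)

module ℚS = +-*-Solver

Σ≤-cong-≤ : ∀ n {f g : ℕ → ℚ} → (∀ i → i ℕ.≤ n → f i ≡ g i) → Σ≤ n f ≡ Σ≤ n g
Σ≤-cong-≤ zero    f≡g = f≡g 0 z≤n
Σ≤-cong-≤ (suc n) f≡g =
  cong₂ ℚ._+_ (Σ≤-cong-≤ n (λ i i≤n → f≡g i (ℕP.m≤n⇒m≤1+n i≤n))) (f≡g (suc n) ℕP.≤-refl)

Σ≤-cong : ∀ n {f g : ℕ → ℚ} → (∀ i → f i ≡ g i) → Σ≤ n f ≡ Σ≤ n g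
Σ≤-cong n f≡g = Σ≤-cong-≤ n (λ i _ → f≡g i)

Σ≤-distrib-+ : ∀ n (f g : ℕ → ℚ) → Σ≤ n (λ i → f i ℚ.+ g i) ≡ Σ≤ n f ℚ.+ Σ≤ n g
Σ≤-distrib-+ zero    f g = refl
Σ≤-distrib-+ (suc n) f g rewrite Σ≤-distrib-+ n f g =
  ℚS.solve 4 (λ a b c d → (a :+ b) :+ (c :+ d) := (a :+ c) :+ (b :+ d)) refl
    (Σ≤ n f) (Σ≤ n g) (f (suc n)) (g (suc n))
  where open ℚS

Σ≤-*ˡ : ∀ n c (f : ℕ → ℚ) → Σ≤ n (λ i → c ℚ.* f i) ≡ c ℚ.* Σ≤ n f
Σ≤-*ˡ zero    c f = refl
Σ≤-*ˡ (suc n) c f rewrite Σ≤-*ˡ n c f = sym (ℚP.*-distribˡ-+ c (Σ≤ n f) (f (suc n)))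

Σ≤-*ʳ : ∀ n c (f : ℕ → ℚ) → Σ≤ n (λ i → f i ℚ.* c) ≡ Σ≤ n f ℚ.* c
Σ≤-*ʳ n c f = trans (Σ≤-cong n (λ i → ℚP.*-comm (f i) c)) (trans (Σ≤-*ˡ n c f) (ℚP.*-comm c _))

Σ≤-neg : ∀ n (f : ℕ → ℚ) → Σ≤ n (λ i → ℚ.- f i) ≡ ℚ.- Σ≤ n f
Σ≤-neg zero    f = refl
Σ≤-neg (suc n) f rewrite Σ≤-neg n f = sym (ℚP.neg-distrib-+ (Σ≤ n f) (f (suc n)))

Σ≤-zero : ∀ n (f : ℕ → ℚ) → (∀ i → i ℕ.≤ n → f i ≡ 0ℚ) → Σ≤ n f ≡ 0ℚ
Σ≤-zero n f f≡0 = trans (Σ≤-cong-≤ n f≡0) (Σ≤-const0 n)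
  where
  Σ≤-const0 : ∀ n → Σ≤ n (λ _ → 0ℚ) ≡ 0ℚ
  Σ≤-const0 zero    = refl
  Σ≤-const0 (suc n) rewrite Σ≤-const0 n = refl

Σ≤-suc-first : ∀ n (f : ℕ → ℚ) → Σ≤ (suc n) f ≡ f 0 ℚ.+ Σ≤ n (λ i → f (suc i))
Σ≤-suc-first zero    f = refl
Σ≤-suc-first (suc n) f rewrite Σ≤-suc-first n f = ℚP.+-assoc (f 0) _ _

Σ≤-only-first : ∀ n (f : ℕ → ℚ) → (∀ i → f (suc i) ≡ 0ℚ) → Σ≤ n f ≡ f 0
Σ≤-only-first zero    f f≡0 = refl
Σ≤-only-first (suc n) f f≡0 rewrite Σ≤-only-first n f f≡0 | f≡0 n = ℚP.+-identityʳ (f 0)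

Σ≤-truncate : ∀ n i (f : ℕ → ℚ) → i ℕ.≤ n → (∀ m → i ℕ.< m → f m ≡ 0ℚ) → Σ≤ n f ≡ Σ≤ i f
Σ≤-truncate n i f i≤n f≡0 = trans (cong (λ k → Σ≤ k f) (sym (ℕP.m∸n+n≡m i≤n))) (extend (n ℕ.∸ i))
  where
  extend : ∀ k → Σ≤ (k ℕ.+ i) f ≡ Σ≤ i f
  extend zero = refl
  extend (suc k) rewrite extend k | f≡0 (suc (k ℕ.+ i)) (s≤s (ℕP.m≤n+m i k)) = ℚP.+-identityʳ _

Σ≤-swap : ∀ n p (h : ℕ → ℕ → ℚ) → Σ≤ n (λ a → Σ≤ p (h a)) ≡ Σ≤ p (λ b → Σ≤ n (λ a → h a b))
Σ≤-swap zero    p h = refl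
Σ≤-swap (suc n) p h rewrite Σ≤-swap n p h =
  sym (Σ≤-distrib-+ p (λ b → Σ≤ n (λ a → h a b)) (h (suc n)))

Σ≤-telescope : ∀ n (t : ℕ → ℚ) → Σ≤ n (λ m → t m ℚ.- t (suc m)) ≡ t 0 ℚ.- t (suc n)
Σ≤-telescope zero    t = refl
Σ≤-telescope (suc n) t rewrite Σ≤-telescope n t =
  ℚS.solve 3 (λ a b c → (a :- b) :+ (b :- c) := a :- c) refl (t 0) (t (suc n)) (t (suc (suc n)))
  where open ℚS

ιℤ : ℤ → ℚ
ιℤ a = a / 1

ι : ℕ → ℚ
ι n = ιℤ (+ n)

private
  toℚᵘ-ιℤ : ∀ a → ℚ.toℚᵘ (ιℤ a) ℚᵘ.≃ mkℚᵘ a 0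
  toℚᵘ-ιℤ a = ℚP.toℚᵘ-fromℚᵘ (mkℚᵘ a 0)

ιℤ-+ : ∀ a b → ιℤ (a ℤ.+ b) ≡ ιℤ a ℚ.+ ιℤ b
ιℤ-+ a b = ℚP.toℚᵘ-injective (ℚᵘP.≃-trans (toℚᵘ-ιℤ (a ℤ.+ b)) (ℚᵘP.≃-sym
  (ℚᵘP.≃-trans (ℚP.toℚᵘ-homo-+ (ιℤ a) (ιℤ b))
    (ℚᵘP.≃-trans (ℚᵘP.+-cong (toℚᵘ-ιℤ a) (toℚᵘ-ιℤ b)) (*≡* (cross a b))))))
  where
  cross : ∀ a b → (a ℤ.* + 1 ℤ.+ b ℤ.* + 1) ℤ.* + 1 ≡ (a ℤ.+ b) ℤ.* + 1
  cross = solve-∀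

ιℤ-* : ∀ a b → ιℤ (a ℤ.* b) ≡ ιℤ a ℚ.* ιℤ b
ιℤ-* a b = ℚP.toℚᵘ-injective (ℚᵘP.≃-trans (toℚᵘ-ιℤ (a ℤ.* b)) (ℚᵘP.≃-sym
  (ℚᵘP.≃-trans (ℚP.toℚᵘ-homo-* (ιℤ a) (ιℤ b))
    (ℚᵘP.≃-trans (ℚᵘP.*-cong (toℚᵘ-ιℤ a) (toℚᵘ-ιℤ b)) (*≡* refl)))))

ιℤ-neg : ∀ a → ιℤ (ℤ.- a) ≡ ℚ.- ιℤ a
ιℤ-neg a = ℚP.toℚᵘ-injective (ℚᵘP.≃-trans (toℚᵘ-ιℤ (ℤ.- a)) (ℚᵘP.≃-sym
  (ℚᵘP.≃-trans (ℚP.toℚᵘ-homo‿- (ιℤ a)) (ℚᵘP.-‿cong (toℚᵘ-ιℤ a)))))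

/-*-ι : ∀ a k .{{_ : ℕ.NonZero k}} → (a / k) ℚ.* ι k ≡ ιℤ a
/-*-ι a (suc k) = ℚP.toℚᵘ-injective (ℚᵘP.≃-trans (ℚP.toℚᵘ-homo-* (a / suc k) (ι (suc k)))
  (ℚᵘP.≃-trans (ℚᵘP.*-cong (ℚP.toℚᵘ-fromℚᵘ (mkℚᵘ a k)) (toℚᵘ-ιℤ (+ suc k)))
    (ℚᵘP.≃-sym (ℚᵘP.≃-trans (toℚᵘ-ιℤ a) (*≡* cross)))))
  where
  cross : a ℤ.* (+ suc k ℤ.* + 1) ≡ (a ℤ.* + suc k) ℤ.* + 1
  cross = trans (cong (a ℤ.*_) (ℤP.*-identityʳ (+ suc k))) (sym (ℤP.*-identityʳ (a ℤ.* + suc k)))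

ι-+ : ∀ m n → ι (m ℕ.+ n) ≡ ι m ℚ.+ ι n
ι-+ m n = trans (cong ιℤ (ℤP.pos-+ m n)) (ιℤ-+ (+ m) (+ n))

ι-* : ∀ m n → ι (m ℕ.* n) ≡ ι m ℚ.* ι n
ι-* m n = trans (cong ιℤ (ℤP.pos-* m n)) (ιℤ-* (+ m) (+ n))

ι-suc : ∀ n → ι (suc n) ≡ 1ℚ ℚ.+ ι n
ι-suc = ι-+ 1

ι-! : ∀ n → ι (suc n !) ≡ ι (suc n) ℚ.* ι (n !)
ι-! n = ι-* (suc n) (n !)

ι-^ : ∀ a k → ι (a ℕ.^ k) ≡ ι a ^ℚ k
ι-^ a zero    = refl
ι-^ a (suc k) = trans (ι-* a (a ℕ.^ k)) (cong (ι a ℚ.*_) (ι-^ a k))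

ι-nonZero : ∀ k .{{_ : ℕ.NonZero k}} → ℚ.NonZero (ι k)
ι-nonZero (suc k) = ℚ.≢-nonZero ι[1+k]≢0
  where
  ι[1+k]≢0 : ι (suc k) ≢ 0ℚ
  ι[1+k]≢0 eq with ℚᵘP.≃-trans (ℚᵘP.≃-sym (toℚᵘ-ιℤ (+ suc k))) (ℚᵘP.≃-trans (ℚP.toℚᵘ-cong eq) (toℚᵘ-ιℤ (+ 0)))
  ... | *≡* ()

*-cancelʳ-ι : ∀ k .{{_ : ℕ.NonZero k}} {a b} → a ℚ.* ι k ≡ b ℚ.* ι k → a ≡ b
*-cancelʳ-ι k {a} {b} eq = begin
  a                      ≡⟨ sym (ℚP.*-identityʳ a) ⟩
  a ℚ.* 1ℚ               ≡⟨ cong (a ℚ.*_) (sym (ℚP.*-inverseʳ (ι k))) ⟩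
  a ℚ.* (ι k ℚ.* ι⁻¹)    ≡⟨ sym (ℚP.*-assoc a (ι k) ι⁻¹) ⟩
  (a ℚ.* ι k) ℚ.* ι⁻¹    ≡⟨ cong (ℚ._* ι⁻¹) eq ⟩
  (b ℚ.* ι k) ℚ.* ι⁻¹    ≡⟨ ℚP.*-assoc b (ι k) ι⁻¹ ⟩
  b ℚ.* (ι k ℚ.* ι⁻¹)    ≡⟨ cong (b ℚ.*_) (ℚP.*-inverseʳ (ι k)) ⟩
  b ℚ.* 1ℚ               ≡⟨ ℚP.*-identityʳ b ⟩
  b                      ∎
  where
  open ≡-Reasoning
  instance _ = ι-nonZero k
  ι⁻¹ = ℚ.1/ ι k

nCk*k![n∸k]!≡n! : ∀ {n k} → k ℕ.≤ n → (n C k) ℕ.* (k ! ℕ.* (n ℕ.∸ k) !) ≡ n !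
nCk*k![n∸k]!≡n! {n} {k} k≤n =
  trans (cong (ℕ._* (k ! ℕ.* (n ℕ.∸ k) !)) (nCk≡n!/k![n-k]! k≤n)) (m/n*n≡m (k![n∸k]!∣n! k≤n))
  where instance _ = k !* (n ℕ.∸ k) !≢0

1^ℚn≡1 : ∀ n → 1ℚ ^ℚ n ≡ 1ℚ
1^ℚn≡1 zero    = refl
1^ℚn≡1 (suc n) = trans (ℚP.*-identityˡ _) (1^ℚn≡1 n)

^ℚ-distribʳ-* : ∀ a b n → (a ℚ.* b) ^ℚ n ≡ (a ^ℚ n) ℚ.* (b ^ℚ n)
^ℚ-distribʳ-* a b zero    = refl
^ℚ-distribʳ-* a b (suc n) =
  trans (cong ((a ℚ.* b) ℚ.*_) (^ℚ-distribʳ-* a b n)) (interchange a b (a ^ℚ n) (b ^ℚ n))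

1/ι! : ℕ → ℚ
1/ι! n = ℚ.1/ ι (n !)
  where instance _ = ι-nonZero (n !) {{n !≢0}}

1/ι!-inverse : ∀ n → 1/ι! n ℚ.* ι (n !) ≡ 1ℚ
1/ι!-inverse n = ℚP.*-inverseˡ (ι (n !))
  where instance _ = ι-nonZero (n !) {{n !≢0}}

infix 4 _≈_
_≈_ : Series → Series → Set
f ≈ g = ∀ n → f n ≡ g n

≈-refl : ∀ {f} → f ≈ f
≈-refl _ = refl

≈-sym : ∀ {f g} → f ≈ g → g ≈ f
≈-sym f≈g n = sym (f≈g n)

≈-trans : ∀ {f g h} → f ≈ g → g ≈ h → f ≈ h
≈-trans f≈g g≈h n = trans (f≈g n) (g≈h n)

infixl 6 _+ˢ_
_+ˢ_ : Series → Series → Series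
(f +ˢ g) n = f n ℚ.+ g n

-ˢ_ : Series → Series
(-ˢ f) n = ℚ.- f n

0ˢ : Series
0ˢ _ = 0ℚ

infixr 7 _·ˢ_
_·ˢ_ : ℚ → Series → Series
(c ·ˢ f) n = c ℚ.* f n

VanishesBelow : ℕ → Series → Set
VanishesBelow m f = ∀ i → i ℕ.< m → f i ≡ 0ℚ

infixl 6 _-ˢ_
_-ˢ_ : Series → Series → Series
f -ˢ g = f +ˢ (-ˢ g)

shift : Series → Series
shift f n = f (suc n)

+ˢ-cong : ∀ {f f′ g g′} → f ≈ f′ → g ≈ g′ → f +ˢ g ≈ f′ +ˢ g′
+ˢ-cong f≈f′ g≈g′ n = cong₂ ℚ._+_ (f≈f′ n) (g≈g′ n)

+ˢ-congʳ : ∀ f {g g′} → g ≈ g′ → f +ˢ g ≈ f +ˢ g′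
+ˢ-congʳ f = +ˢ-cong (≈-refl {f})

+ˢ-congˡ : ∀ {f f′} g → f ≈ f′ → f +ˢ g ≈ f′ +ˢ g
+ˢ-congˡ g f≈f′ = +ˢ-cong f≈f′ (≈-refl {g})

-ˢ-cong : ∀ {f g} → f ≈ g → -ˢ f ≈ -ˢ g
-ˢ-cong f≈g n = cong ℚ.-_ (f≈g n)

⊛-cong : ∀ {f f′ g g′} → f ≈ f′ → g ≈ g′ → f ⊛ g ≈ f′ ⊛ g′
⊛-cong f≈f′ g≈g′ n = Σ≤-cong n (λ i → cong₂ ℚ._*_ (f≈f′ i) (g≈g′ (n ℕ.∸ i)))

⊛-congˡ : ∀ {f f′} g → f ≈ f′ → f ⊛ g ≈ f′ ⊛ g
⊛-congˡ g f≈f′ = ⊛-cong f≈f′ (≈-refl {g})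

⊛-congʳ : ∀ f {g g′} → g ≈ g′ → f ⊛ g ≈ f ⊛ g′
⊛-congʳ f = ⊛-cong (≈-refl {f})

⊛-suc : ∀ f g n → (f ⊛ g) (suc n) ≡ f 0 ℚ.* g (suc n) ℚ.+ (shift f ⊛ g) n
⊛-suc f g n = Σ≤-suc-first n (λ i → f i ℚ.* g (suc n ℕ.∸ i))

⊛-distribʳ-+ˢ : ∀ h f g → (f +ˢ g) ⊛ h ≈ (f ⊛ h) +ˢ (g ⊛ h)
⊛-distribʳ-+ˢ h f g n =
  trans (Σ≤-cong n (λ i → ℚP.*-distribʳ-+ (h (n ℕ.∸ i)) (f i) (g i))) (Σ≤-distrib-+ n _ _)

⊛-distribˡ-+ˢ : ∀ h f g → h ⊛ (f +ˢ g) ≈ (h ⊛ f) +ˢ (h ⊛ g)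
⊛-distribˡ-+ˢ h f g n =
  trans (Σ≤-cong n (λ i → ℚP.*-distribˡ-+ (h i) (f (n ℕ.∸ i)) (g (n ℕ.∸ i)))) (Σ≤-distrib-+ n _ _)

·ˢ-⊛ : ∀ c f g → (c ·ˢ f) ⊛ g ≈ c ·ˢ (f ⊛ g)
·ˢ-⊛ c f g n = trans (Σ≤-cong n (λ i → ℚP.*-assoc c (f i) (g (n ℕ.∸ i)))) (Σ≤-*ˡ n c _)

⊛-comm : ∀ f g → f ⊛ g ≈ g ⊛ f
⊛-comm f g zero = ℚP.*-comm (f 0) (g 0)
⊛-comm f g (suc zero) =
  ℚS.solve 4 (λ a b c d → a :* b :+ c :* d := d :* c :+ b :* a) refl (f 0) (g 1) (f 1) (g 0)
  where open ℚS
⊛-comm f g (suc (suc k)) = begin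
  (f ⊛ g) (suc (suc k))
    ≡⟨ ⊛-suc f g (suc k) ⟩
  f 0 ℚ.* g (2 ℕ.+ k) ℚ.+ (shift f ⊛ g) (suc k)
    ≡⟨ cong (f 0 ℚ.* g (2 ℕ.+ k) ℚ.+_) (trans (⊛-comm (shift f) g (suc k)) (⊛-suc g (shift f) k)) ⟩
  f 0 ℚ.* g (2 ℕ.+ k) ℚ.+ (g 0 ℚ.* f (2 ℕ.+ k) ℚ.+ (shift g ⊛ shift f) k)
    ≡⟨ cong (λ z → f 0 ℚ.* g (2 ℕ.+ k) ℚ.+ (g 0 ℚ.* f (2 ℕ.+ k) ℚ.+ z)) (⊛-comm (shift g) (shift f) k) ⟩
  f 0 ℚ.* g (2 ℕ.+ k) ℚ.+ (g 0 ℚ.* f (2 ℕ.+ k) ℚ.+ (shift f ⊛ shift g) k)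
    ≡⟨ ℚS.solve 5 (λ a b c d e → a :* b :+ (c :* d :+ e) := c :* d :+ (a :* b :+ e)) refl
         (f 0) (g (2 ℕ.+ k)) (g 0) (f (2 ℕ.+ k)) ((shift f ⊛ shift g) k) ⟩
  g 0 ℚ.* f (2 ℕ.+ k) ℚ.+ (f 0 ℚ.* g (2 ℕ.+ k) ℚ.+ (shift f ⊛ shift g) k)
    ≡⟨ cong (g 0 ℚ.* f (2 ℕ.+ k) ℚ.+_) (sym (trans (⊛-comm (shift g) f (suc k)) (⊛-suc f (shift g) k))) ⟩
  g 0 ℚ.* f (2 ℕ.+ k) ℚ.+ (shift g ⊛ f) (suc k)
    ≡⟨ sym (⊛-suc g f (suc k)) ⟩
  (g ⊛ f) (suc (suc k)) ∎
  where open ≡-Reasoning; open ℚS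

⊛-assoc : ∀ f g h → (f ⊛ g) ⊛ h ≈ f ⊛ (g ⊛ h)
⊛-assoc f g h zero    = ℚP.*-assoc (f 0) (g 0) (h 0)
⊛-assoc f g h (suc n) = begin
  ((f ⊛ g) ⊛ h) (suc n)
    ≡⟨ ⊛-suc (f ⊛ g) h n ⟩
  (f 0 ℚ.* g 0) ℚ.* h (suc n) ℚ.+ (shift (f ⊛ g) ⊛ h) n
    ≡⟨ cong ((f 0 ℚ.* g 0) ℚ.* h (suc n) ℚ.+_) shift-assoc ⟩
  (f 0 ℚ.* g 0) ℚ.* h (suc n) ℚ.+ (f 0 ℚ.* (shift g ⊛ h) n ℚ.+ (shift f ⊛ (g ⊛ h)) n)
    ≡⟨ ℚS.solve 5 (λ a b c d e → (a :* b) :* c :+ (a :* d :+ e) := a :* (b :* c :+ d) :+ e) refl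
         (f 0) (g 0) (h (suc n)) ((shift g ⊛ h) n) ((shift f ⊛ (g ⊛ h)) n) ⟩
  f 0 ℚ.* (g 0 ℚ.* h (suc n) ℚ.+ (shift g ⊛ h) n) ℚ.+ (shift f ⊛ (g ⊛ h)) n
    ≡⟨ cong (λ z → f 0 ℚ.* z ℚ.+ (shift f ⊛ (g ⊛ h)) n) (sym (⊛-suc g h n)) ⟩
  f 0 ℚ.* (g ⊛ h) (suc n) ℚ.+ (shift f ⊛ (g ⊛ h)) n
    ≡⟨ sym (⊛-suc f (g ⊛ h) n) ⟩
  (f ⊛ (g ⊛ h)) (suc n) ∎
  where
  open ≡-Reasoning; open ℚS
  shift-assoc : (shift (f ⊛ g) ⊛ h) n ≡ f 0 ℚ.* (shift g ⊛ h) n ℚ.+ (shift f ⊛ (g ⊛ h)) n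
  shift-assoc = begin
    (shift (f ⊛ g) ⊛ h) n
      ≡⟨ ⊛-congˡ h (⊛-suc f g) n ⟩
    ((f 0 ·ˢ shift g +ˢ shift f ⊛ g) ⊛ h) n
      ≡⟨ ⊛-distribʳ-+ˢ h (f 0 ·ˢ shift g) (shift f ⊛ g) n ⟩
    ((f 0 ·ˢ shift g) ⊛ h) n ℚ.+ ((shift f ⊛ g) ⊛ h) n
      ≡⟨ cong₂ ℚ._+_ (·ˢ-⊛ (f 0) (shift g) h n) (⊛-assoc (shift f) g h n) ⟩
    f 0 ℚ.* (shift g ⊛ h) n ℚ.+ (shift f ⊛ (g ⊛ h)) n ∎

one-⊛ : ∀ f → one ⊛ f ≈ f
one-⊛ f n = trans (Σ≤-only-first n _ (λ i → ℚP.*-zeroˡ (f (n ℕ.∸ suc i)))) (ℚP.*-identityˡ (f n))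

⊛-one : ∀ f → f ⊛ one ≈ f
⊛-one f n = trans (⊛-comm f one n) (one-⊛ f n)

seriesRing : CommutativeRing _ _
seriesRing = record
  { Carrier = Series ; _≈_ = _≈_ ; _+_ = _+ˢ_ ; _*_ = _⊛_ ; -_ = -ˢ_ ; 0# = 0ˢ ; 1# = one
  ; isCommutativeRing = record
    { isRing = record
      { +-isAbelianGroup = record
        { isGroup = record
          { isMonoid = record
            { isSemigroup = record
              { isMagma = record { isEquivalence = ≈-isEquivalence ; ∙-cong = +ˢ-cong }
              ; assoc = λ f g h n → ℚP.+-assoc (f n) (g n) (h n) }
            ; identity = (λ f n → ℚP.+-identityˡ (f n)) , (λ f n → ℚP.+-identityʳ (f n)) }
          ; inverse = (λ f n → ℚP.+-inverseˡ (f n)) , (λ f n → ℚP.+-inverseʳ (f n))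
          ; ⁻¹-cong = -ˢ-cong }
        ; comm = λ f g n → ℚP.+-comm (f n) (g n) }
      ; *-cong = ⊛-cong
      ; *-assoc = ⊛-assoc
      ; *-identity = one-⊛ , ⊛-one
      ; distrib = ⊛-distribˡ-+ˢ , ⊛-distribʳ-+ˢ }
    ; *-comm = ⊛-comm } }
  where
  ≈-isEquivalence : IsEquivalence _≈_
  ≈-isEquivalence = record { refl = ≈-refl ; sym = ≈-sym ; trans = ≈-trans }

κ : ℚ → Series
κ c zero    = c
κ c (suc n) = 0ℚ

κ-cong : ∀ {a b} → a ≡ b → κ a ≈ κ b
κ-cong a≡b n = cong (λ c → κ c n) a≡b

κ-+ : ∀ a b → κ (a ℚ.+ b) ≈ κ a +ˢ κ b
κ-+ a b zero    = refl
κ-+ a b (suc n) = refl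

κ-* : ∀ a b → κ (a ℚ.* b) ≈ κ a ⊛ κ b
κ-* a b zero    = refl
κ-* a b (suc n) = sym (Σ≤-zero (suc n) _ vanish)
  where
  vanish : ∀ i → i ℕ.≤ suc n → κ a i ℚ.* κ b (suc n ℕ.∸ i) ≡ 0ℚ
  vanish zero    _ = ℚP.*-zeroʳ a
  vanish (suc i) _ = ℚP.*-zeroˡ (κ b (n ℕ.∸ i))

κ-neg : ∀ a → κ (ℚ.- a) ≈ -ˢ κ a
κ-neg a zero    = refl
κ-neg a (suc n) = refl

κ-0 : κ 0ℚ ≈ 0ˢ
κ-0 zero    = refl
κ-0 (suc n) = refl

κ-1 : κ 1ℚ ≈ one
κ-1 zero    = refl
κ-1 (suc n) = refl

κ-⊛ : ∀ c f → κ c ⊛ f ≈ c ·ˢ f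
κ-⊛ c f n = Σ≤-only-first n _ (λ i → ℚP.*-zeroˡ (f (n ℕ.∸ suc i)))

𝟙 : Series
𝟙 = κ 1ℚ

κℕ : ℕ → Series
κℕ m = κ (ι m)

κℕ-suc : ∀ m → κℕ (suc m) ≈ 𝟙 +ˢ κℕ m
κℕ-suc m = ≈-trans (κ-cong (ι-suc m)) (κ-+ 1ℚ (ι m))

-- m + 1, unfolded so that the ring solver sees its relation to κℕ m.
κ[1+_] : ℕ → Series
κ[1+ m ] = 𝟙 +ˢ κℕ m

Z : Series
Z zero          = 0ℚ
Z (suc zero)    = 1ℚ
Z (suc (suc n)) = 0ℚ

Z-⊛-zero : ∀ f → (Z ⊛ f) 0 ≡ 0ℚ
Z-⊛-zero f = ℚP.*-zeroˡ (f 0)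

Z-⊛-suc : ∀ f n → (Z ⊛ f) (suc n) ≡ f n
Z-⊛-suc f n = begin
  (Z ⊛ f) (suc n)                       ≡⟨ ⊛-suc Z f n ⟩
  0ℚ ℚ.* f (suc n) ℚ.+ (shift Z ⊛ f) n  ≡⟨ cong (ℚ._+ (shift Z ⊛ f) n) (ℚP.*-zeroˡ (f (suc n))) ⟩
  0ℚ ℚ.+ (shift Z ⊛ f) n                ≡⟨ ℚP.+-identityˡ _ ⟩
  (shift Z ⊛ f) n                       ≡⟨ ⊛-congˡ f shift-Z n ⟩
  (one ⊛ f) n                           ≡⟨ one-⊛ f n ⟩
  f n                                   ∎
  where
  open ≡-Reasoning
  shift-Z : shift Z ≈ one
  shift-Z zero    = refl
  shift-Z (suc k) = refl

D : Series → Series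
D f n = ι (suc n) ℚ.* f (suc n)

D-cong : ∀ {f g} → f ≈ g → D f ≈ D g
D-cong f≈g n = cong (ι (suc n) ℚ.*_) (f≈g (suc n))

D-+ : ∀ f g → D (f +ˢ g) ≈ D f +ˢ D g
D-+ f g n = ℚP.*-distribˡ-+ (ι (suc n)) (f (suc n)) (g (suc n))

D-neg : ∀ f → D (-ˢ f) ≈ -ˢ D f
D-neg f n = sym (ℚP.neg-distribʳ-* (ι (suc n)) (f (suc n)))

D-κ : ∀ c → D (κ c) ≈ κ 0ℚ
D-κ c = ≈-trans (λ n → ℚP.*-zeroʳ (ι (suc n))) (≈-sym κ-0)

-- t d/dt is a derivation because i + (n - i) = n, and D is its shift.
private
  Euler : Series → Series
  Euler f n = ι n ℚ.* f n

  Euler-Leibniz : ∀ f g → Euler (f ⊛ g) ≈ (Euler f ⊛ g) +ˢ (f ⊛ Euler g)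
  Euler-Leibniz f g n = begin
    ι n ℚ.* Σ≤ n (λ i → f i ℚ.* g (n ℕ.∸ i))
      ≡⟨ sym (Σ≤-*ˡ n (ι n) _) ⟩
    Σ≤ n (λ i → ι n ℚ.* (f i ℚ.* g (n ℕ.∸ i)))
      ≡⟨ Σ≤-cong-≤ n split ⟩
    Σ≤ n (λ i → (ι i ℚ.* f i) ℚ.* g (n ℕ.∸ i) ℚ.+ f i ℚ.* (ι (n ℕ.∸ i) ℚ.* g (n ℕ.∸ i)))
      ≡⟨ Σ≤-distrib-+ n _ _ ⟩
    ((Euler f ⊛ g) +ˢ (f ⊛ Euler g)) n ∎
    where
    open ≡-Reasoning
    split : ∀ i → i ℕ.≤ n →
      ι n ℚ.* (f i ℚ.* g (n ℕ.∸ i)) ≡ (ι i ℚ.* f i) ℚ.* g (n ℕ.∸ i) ℚ.+ f i ℚ.* (ι (n ℕ.∸ i) ℚ.* g (n ℕ.∸ i))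
    split i i≤n = trans
      (cong (ℚ._* (f i ℚ.* g (n ℕ.∸ i))) (trans (cong ι (sym (ℕP.m+[n∸m]≡n i≤n))) (ι-+ i (n ℕ.∸ i))))
      (ℚS.solve 4 (λ a b c d → (a :+ b) :* (c :* d) := (a :* c) :* d :+ c :* (b :* d)) refl
        (ι i) (ι (n ℕ.∸ i)) (f i) (g (n ℕ.∸ i)))
      where open ℚS

D-Leibniz : ∀ f g → D (f ⊛ g) ≈ (D f ⊛ g) +ˢ (f ⊛ D g)
D-Leibniz f g n = begin
  Euler (f ⊛ g) (suc n)
    ≡⟨ Euler-Leibniz f g (suc n) ⟩
  (Euler f ⊛ g) (suc n) ℚ.+ (f ⊛ Euler g) (suc n)
    ≡⟨ cong₂ ℚ._+_ (⊛-suc (Euler f) g n) (trans (⊛-comm f (Euler g) (suc n)) (⊛-suc (Euler g) f n)) ⟩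
  (0ℚ ℚ.* f 0 ℚ.* g (suc n) ℚ.+ (D f ⊛ g) n) ℚ.+ (0ℚ ℚ.* g 0 ℚ.* f (suc n) ℚ.+ (D g ⊛ f) n)
    ≡⟨ ℚS.solve 6 (λ a b c d x y → (con 0ℚ :* a :* b :+ x) :+ (con 0ℚ :* c :* d :+ y) := x :+ y) refl
         (f 0) (g (suc n)) (g 0) (f (suc n)) ((D f ⊛ g) n) ((D g ⊛ f) n) ⟩
  (D f ⊛ g) n ℚ.+ (D g ⊛ f) n
    ≡⟨ cong ((D f ⊛ g) n ℚ.+_) (⊛-comm (D g) f n) ⟩
  (D f ⊛ g) n ℚ.+ (f ⊛ D g) n ∎
  where open ≡-Reasoning; open ℚS

D-κ-⊛ : ∀ c f → D (κ c ⊛ f) ≈ κ c ⊛ D f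
D-κ-⊛ c f n = begin
  ι (suc n) ℚ.* (κ c ⊛ f) (suc n)   ≡⟨ cong (ι (suc n) ℚ.*_) (κ-⊛ c f (suc n)) ⟩
  ι (suc n) ℚ.* (c ℚ.* f (suc n))   ≡⟨ x∙yz≈y∙xz (ι (suc n)) c (f (suc n)) ⟩
  c ℚ.* D f n                       ≡⟨ κ-⊛ c (D f) n ⟨
  (κ c ⊛ D f) n                     ∎
  where open ≡-Reasoning

private
  κ-morphism : ACR._-Raw-AlmostCommutative⟶_
                 (CommutativeRing.rawRing ℚP.+-*-commutativeRing) (ACR.fromCommutativeRing seriesRing)
  κ-morphism = record
    { ⟦_⟧ = κ ; +-homo = κ-+ ; *-homo = κ-* ; -‿homo = κ-neg ; 0-homo = κ-0 ; 1-homo = κ-1 }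

  κ-≟ : WeaklyDecidable (ACR.Induced-equivalence κ-morphism)
  κ-≟ a b with a ℚP.≟ b
  ... | yes a≡b = just (κ-cong a≡b)
  ... | no _    = nothing

open import Algebra.Solver.Ring
  (CommutativeRing.rawRing ℚP.+-*-commutativeRing) (ACR.fromCommutativeRing seriesRing) κ-morphism κ-≟
  using (solve; con; _:+_; _:*_; _:-_; :-_; _:=_)

module ≈-Reasoning = SetoidReasoning (CommutativeRing.setoid seriesRing)

≈-modulo : ∀ {L R} A H → L ≈ R +ˢ A ⊛ H → H ≈ κ 0ℚ → L ≈ R
≈-modulo {L} {R} A H L≈R+AH H≈0 = begin
  L               ≈⟨ L≈R+AH ⟩
  R +ˢ A ⊛ H      ≈⟨ +ˢ-congʳ R (⊛-congʳ A H≈0) ⟩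
  R +ˢ A ⊛ κ 0ℚ   ≈⟨ solve 2 (λ R A → R :+ A :* con 0ℚ := R) ≈-refl R A ⟩
  R               ∎
  where open ≈-Reasoning

≈⇒difference≈0 : ∀ {a b} → a ≈ b → a -ˢ b ≈ κ 0ℚ
≈⇒difference≈0 {a} {b} a≈b = begin
  a -ˢ b   ≈⟨ +ˢ-congˡ (-ˢ b) a≈b ⟩
  b -ˢ b   ≈⟨ solve 1 (λ b → b :- b := con 0ℚ) ≈-refl b ⟩
  κ 0ℚ     ∎
  where open ≈-Reasoning

⊛-cancelˡ-invertible : ∀ e e⁻¹ f g → e ⊛ e⁻¹ ≈ κ 1ℚ → e ⊛ f ≈ e ⊛ g → f ≈ g
⊛-cancelˡ-invertible e e⁻¹ f g ee⁻¹≈1 ef≈eg = begin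
  f                  ≈⟨ solve 1 (λ F → F := con 1ℚ :* F) ≈-refl f ⟩
  κ 1ℚ ⊛ f           ≈⟨ ⊛-congˡ f (≈-sym ee⁻¹≈1) ⟩
  (e ⊛ e⁻¹) ⊛ f      ≈⟨ solve 3 (λ E E' F → (E :* E') :* F := (E :* F) :* E') ≈-refl e e⁻¹ f ⟩
  (e ⊛ f) ⊛ e⁻¹      ≈⟨ ⊛-congˡ e⁻¹ ef≈eg ⟩
  (e ⊛ g) ⊛ e⁻¹      ≈⟨ solve 3 (λ E E' G → (E :* G) :* E' := (E :* E') :* G) ≈-refl e e⁻¹ g ⟩
  (e ⊛ e⁻¹) ⊛ g      ≈⟨ ⊛-congˡ g ee⁻¹≈1 ⟩
  κ 1ℚ ⊛ g           ≈⟨ solve 1 (λ G → con 1ℚ :* G := G) ≈-refl g ⟩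
  g                  ∎
  where open ≈-Reasoning

-- u = 1 - e^{-t} and the sequences U m n = n! [t^n] u^m

D-u : D u ≈ 𝟙 -ˢ u
D-u zero    = refl
D-u (suc n) = *-cancelʳ-ι (suc n !) {{suc n !≢0}} (begin
  (ι (2 ℕ.+ n) ℚ.* u (2 ℕ.+ n)) ℚ.* ι (suc n !)   ≡⟨ xy∙z≈y∙xz (ι (2 ℕ.+ n)) (u (2 ℕ.+ n)) (ι (suc n !)) ⟩
  u (2 ℕ.+ n) ℚ.* (ι (2 ℕ.+ n) ℚ.* ι (suc n !))   ≡⟨ cong (u (2 ℕ.+ n) ℚ.*_) (ι-! (suc n)) ⟨
  u (2 ℕ.+ n) ℚ.* ι (suc (suc n) !)               ≡⟨ u-suc-* (suc n) ⟩
  ιℤ (ℤ.-1ℤ ℤ.* ℤ.-1ℤ ℤ.^ (2 ℕ.+ n))              ≡⟨ cong ιℤ (ℤP.-1*i≡-i (ℤ.-1ℤ ℤ.^ (2 ℕ.+ n))) ⟩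
  ιℤ (ℤ.- (ℤ.-1ℤ ℤ.^ (2 ℕ.+ n)))                  ≡⟨ ιℤ-neg (ℤ.-1ℤ ℤ.^ (2 ℕ.+ n)) ⟩
  ℚ.- ιℤ (ℤ.-1ℤ ℤ.^ (2 ℕ.+ n))                    ≡⟨ cong ℚ.-_ (u-suc-* n) ⟨
  ℚ.- (u (suc n) ℚ.* ι (suc n !))                 ≡⟨ ℚP.neg-distribˡ-* (u (suc n)) (ι (suc n !)) ⟩
  (ℚ.- u (suc n)) ℚ.* ι (suc n !)                 ≡⟨ cong (ℚ._* ι (suc n !)) (ℚP.+-identityˡ (ℚ.- u (suc n))) ⟨
  (0ℚ ℚ.- u (suc n)) ℚ.* ι (suc n !)              ∎)
  where
  open ≡-Reasoning
  u-suc-* : ∀ n → u (suc n) ℚ.* ι (suc n !) ≡ ιℤ (ℤ.-1ℤ ℤ.^ suc (suc n))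
  u-suc-* n = /-*-ι (ℤ.-1ℤ ℤ.^ suc (suc n)) (suc n !) {{suc n !≢0}}

D-upow : ∀ m → D (upow (suc m)) ≈ κℕ (suc m) ⊛ (upow m ⊛ (𝟙 -ˢ u))
D-upow zero = begin
  D (one ⊛ u)                       ≈⟨ D-Leibniz one u ⟩
  D one ⊛ u +ˢ one ⊛ D u            ≈⟨ +ˢ-cong (⊛-congˡ u (D-κ 1ℚ)) (⊛-congʳ one D-u) ⟩
  κ 0ℚ ⊛ u +ˢ one ⊛ (𝟙 -ˢ u)
    ≈⟨ solve 2 (λ P u → con 0ℚ :* u :+ P :* (con 1ℚ :- u) := con 1ℚ :* (P :* (con 1ℚ :- u))) ≈-refl one u ⟩
  κℕ 1 ⊛ (one ⊛ (𝟙 -ˢ u))           ∎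
  where open ≈-Reasoning
D-upow (suc m) = begin
  D (uᵐ⁺¹ ⊛ u)                      ≈⟨ D-Leibniz uᵐ⁺¹ u ⟩
  D uᵐ⁺¹ ⊛ u +ˢ uᵐ⁺¹ ⊛ D u          ≈⟨ +ˢ-cong (⊛-congˡ u (D-upow m)) (⊛-congʳ uᵐ⁺¹ D-u) ⟩
  (κℕ (suc m) ⊛ (uᵐ ⊛ (𝟙 -ˢ u))) ⊛ u +ˢ uᵐ⁺¹ ⊛ (𝟙 -ˢ u)
    ≈⟨ solve 3 (λ C uᵐ u → (C :* (uᵐ :* (con 1ℚ :- u))) :* u :+ (uᵐ :* u) :* (con 1ℚ :- u)
                          := (con 1ℚ :+ C) :* ((uᵐ :* u) :* (con 1ℚ :- u))) ≈-refl (κℕ (suc m)) uᵐ u ⟩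
  κ[1+ suc m ] ⊛ (uᵐ⁺¹ ⊛ (𝟙 -ˢ u))
    ≈⟨ ⊛-congˡ (uᵐ⁺¹ ⊛ (𝟙 -ˢ u)) (κℕ-suc (suc m)) ⟨
  κℕ (2 ℕ.+ m) ⊛ (uᵐ⁺¹ ⊛ (𝟙 -ˢ u)) ∎
  where
  open ≈-Reasoning
  uᵐ = upow m
  uᵐ⁺¹ = upow (suc m)

-- As a generating function in z, U m = m! z^m / ∏_{j ≤ m} (1 + jz).
U : ℕ → Series
U m n = ι (n !) ℚ.* upow m n

U-suc-suc : ∀ m n → U (suc m) (suc n) ≡ ι (suc m) ℚ.* (U m n ℚ.- U (suc m) n)
U-suc-suc m n = begin
  ι (suc n !) ℚ.* upow (suc m) (suc n)                  ≡⟨ cong (ℚ._* upow (suc m) (suc n)) (ι-! n) ⟩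
  (ι (suc n) ℚ.* ι (n !)) ℚ.* upow (suc m) (suc n)      ≡⟨ xy∙z≈y∙xz (ι (suc n)) (ι (n !)) _ ⟩
  ι (n !) ℚ.* D (upow (suc m)) n                        ≡⟨ cong (ι (n !) ℚ.*_) D-upow-coefficient ⟩
  ι (n !) ℚ.* (c ℚ.* (upow m n ℚ.- upow (suc m) n))     ≡⟨ x∙yz≈y∙xz (ι (n !)) c _ ⟩
  c ℚ.* (ι (n !) ℚ.* (upow m n ℚ.- upow (suc m) n))     ≡⟨ cong (c ℚ.*_) distrib ⟩
  c ℚ.* (U m n ℚ.- U (suc m) n)                         ∎
  where
  open ≡-Reasoning
  c = ι (suc m)
  D-upow-coefficient : D (upow (suc m)) n ≡ c ℚ.* (upow m n ℚ.- upow (suc m) n)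
  D-upow-coefficient = trans (D-upow m n) (trans (κ-⊛ c (upow m ⊛ (𝟙 -ˢ u)) n) (cong (c ℚ.*_)
    (solve 2 (λ P u → P :* (con 1ℚ :- u) := P :- P :* u) ≈-refl (upow m) u n)))
  distrib : ι (n !) ℚ.* (upow m n ℚ.- upow (suc m) n) ≡ U m n ℚ.- U (suc m) n
  distrib = trans (ℚP.*-distribˡ-+ (ι (n !)) _ _)
                  (cong (U m n ℚ.+_) (sym (ℚP.neg-distribʳ-* (ι (n !)) (upow (suc m) n))))

U-suc-zero : ∀ m → U (suc m) 0 ≡ 0ℚ
U-suc-zero m = trans (ℚP.*-identityˡ _) (ℚP.*-zeroʳ (upow m 0))

U-zero : U 0 ≈ κ 1ℚ
U-zero zero    = refl
U-zero (suc n) = ℚP.*-zeroʳ (ι (suc n !))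

U-suc : ∀ m → U (suc m) ≈ κℕ (suc m) ⊛ (Z ⊛ (U m -ˢ U (suc m)))
U-suc m zero = begin
  U (suc m) 0                                ≡⟨ U-suc-zero m ⟩
  0ℚ                                         ≡⟨ ℚP.*-zeroʳ (ι (suc m)) ⟨
  ι (suc m) ℚ.* 0ℚ                           ≡⟨ cong (ι (suc m) ℚ.*_) (Z-⊛-zero (U m -ˢ U (suc m))) ⟨
  ι (suc m) ℚ.* (Z ⊛ (U m -ˢ U (suc m))) 0   ≡⟨ κ-⊛ (ι (suc m)) (Z ⊛ (U m -ˢ U (suc m))) 0 ⟨
  (κℕ (suc m) ⊛ (Z ⊛ (U m -ˢ U (suc m)))) 0 ∎
  where open ≡-Reasoning
U-suc m (suc n) = begin
  U (suc m) (suc n)                                  ≡⟨ U-suc-suc m n ⟩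
  ι (suc m) ℚ.* (U m n ℚ.- U (suc m) n)              ≡⟨ cong (ι (suc m) ℚ.*_) (Z-⊛-suc (U m -ˢ U (suc m)) n) ⟨
  ι (suc m) ℚ.* (Z ⊛ (U m -ˢ U (suc m))) (suc n)     ≡⟨ κ-⊛ (ι (suc m)) (Z ⊛ (U m -ˢ U (suc m))) (suc n) ⟨
  (κℕ (suc m) ⊛ (Z ⊛ (U m -ˢ U (suc m)))) (suc n) ∎
  where open ≡-Reasoning

U-vanishes : ∀ m → VanishesBelow m (U m)
U-vanishes (suc m) zero    _         = U-suc-zero m
U-vanishes (suc m) (suc n) (s≤s n<m) = begin
  U (suc m) (suc n)                       ≡⟨ U-suc-suc m n ⟩
  ι (suc m) ℚ.* (U m n ℚ.- U (suc m) n)   ≡⟨ cong₂ (λ a b → ι (suc m) ℚ.* (a ℚ.- b))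
                                              (U-vanishes m n n<m) (U-vanishes (suc m) n (ℕP.m<n⇒m<1+n n<m)) ⟩
  ι (suc m) ℚ.* (0ℚ ℚ.- 0ℚ)               ≡⟨ ℚP.*-zeroʳ (ι (suc m)) ⟩
  0ℚ                                      ∎
  where open ≡-Reasoning

1-_·Z : Series → Series
1- c ·Z = 𝟙 -ˢ c ⊛ Z

1-·Z-cong : ∀ {c d} → c ≈ d → 1- c ·Z ≈ 1- d ·Z
1-·Z-cong c≈d = +ˢ-congʳ 𝟙 (-ˢ-cong (⊛-congˡ Z c≈d))

geom : ℚ → Series
geom c n = c ^ℚ n

[1-cz]geom≈1 : ∀ c → (1- κ c ·Z) ⊛ geom c ≈ 𝟙
[1-cz]geom≈1 c = ≈-modulo 𝟙 (geom c -ˢ (𝟙 +ˢ κ c ⊛ (Z ⊛ geom c)))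
  (solve 3 (λ C Z G → (con 1ℚ :- C :* Z) :* G := con 1ℚ :+ con 1ℚ :* (G :- (con 1ℚ :+ C :* (Z :* G))))
     ≈-refl (κ c) Z (geom c))
  (≈⇒difference≈0 geom-unfold)
  where
  geom-unfold : geom c ≈ 𝟙 +ˢ κ c ⊛ (Z ⊛ geom c)
  geom-unfold zero = sym (begin
    1ℚ ℚ.+ (κ c ⊛ (Z ⊛ geom c)) 0     ≡⟨ cong (1ℚ ℚ.+_) (κ-⊛ c (Z ⊛ geom c) 0) ⟩
    1ℚ ℚ.+ c ℚ.* (Z ⊛ geom c) 0       ≡⟨ cong (λ x → 1ℚ ℚ.+ c ℚ.* x) (Z-⊛-zero (geom c)) ⟩
    1ℚ ℚ.+ c ℚ.* 0ℚ                   ≡⟨ cong (1ℚ ℚ.+_) (ℚP.*-zeroʳ c) ⟩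
    1ℚ                                ∎)
    where open ≡-Reasoning
  geom-unfold (suc n) = sym (begin
    0ℚ ℚ.+ (κ c ⊛ (Z ⊛ geom c)) (suc n)   ≡⟨ ℚP.+-identityˡ _ ⟩
    (κ c ⊛ (Z ⊛ geom c)) (suc n)          ≡⟨ κ-⊛ c (Z ⊛ geom c) (suc n) ⟩
    c ℚ.* (Z ⊛ geom c) (suc n)            ≡⟨ cong (c ℚ.*_) (Z-⊛-suc (geom c) n) ⟩
    c ℚ.* c ^ℚ n                          ∎)
    where open ≡-Reasoning

[1-[m+1]z]geom≈1 : ∀ m → (1- κ[1+ m ] ·Z) ⊛ geom (ι (suc m)) ≈ 𝟙
[1-[m+1]z]geom≈1 m = ≈-trans (⊛-congˡ (geom (ι (suc m))) (1-·Z-cong (≈-sym (κℕ-suc m)))) ([1-cz]geom≈1 (ι (suc m)))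

[1-[m+2]z]geom≈1 : ∀ m → (1- 𝟙 +ˢ κ[1+ m ] ·Z) ⊛ geom (ι (2 ℕ.+ m)) ≈ 𝟙
[1-[m+2]z]geom≈1 m = ≈-trans (⊛-congˡ (geom (ι (2 ℕ.+ m))) (1-·Z-cong (+ˢ-congʳ 𝟙 (≈-sym (κℕ-suc m)))))
                             ([1-[m+1]z]geom≈1 (suc m))

[1+mz]geom[-m]≈1 : ∀ m → (𝟙 +ˢ κℕ m ⊛ Z) ⊛ geom (ℚ.- ι m) ≈ 𝟙
[1+mz]geom[-m]≈1 m = ≈-trans (⊛-congˡ (geom (ℚ.- ι m)) 1+mZ≈1-[-m]Z) ([1-cz]geom≈1 (ℚ.- ι m))
  where
  1+mZ≈1-[-m]Z : 𝟙 +ˢ κℕ m ⊛ Z ≈ 1- κ (ℚ.- ι m) ·Z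
  1+mZ≈1-[-m]Z = ≈-trans (solve 2 (λ M Z → con 1ℚ :+ M :* Z := con 1ℚ :- (:- M) :* Z) ≈-refl (κℕ m) Z)
                         (+ˢ-congʳ 𝟙 (-ˢ-cong (⊛-congˡ Z (≈-sym (κ-neg (ι m))))))

T : Series → Series
T f n = Σ≤ n (λ i → ι (n C i) ℚ.* f i)

T-cong : ∀ {f g} → f ≈ g → T f ≈ T g
T-cong f≈g n = Σ≤-cong n (λ i → cong (ι (n C i) ℚ.*_) (f≈g i))

T-+ : ∀ f g → T (f +ˢ g) ≈ T f +ˢ T g
T-+ f g n = trans (Σ≤-cong n (λ i → ℚP.*-distribˡ-+ (ι (n C i)) (f i) (g i))) (Σ≤-distrib-+ n _ _)

T-neg : ∀ f → T (-ˢ f) ≈ -ˢ T f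
T-neg f n = trans (Σ≤-cong n (λ i → sym (ℚP.neg-distribʳ-* (ι (n C i)) (f i)))) (Σ≤-neg n _)

T-κ-⊛ : ∀ c f → T (κ c ⊛ f) ≈ κ c ⊛ T f
T-κ-⊛ c f n = begin
  Σ≤ n (λ i → ι (n C i) ℚ.* (κ c ⊛ f) i)   ≡⟨ Σ≤-cong n (λ i → cong (ι (n C i) ℚ.*_) (κ-⊛ c f i)) ⟩
  Σ≤ n (λ i → ι (n C i) ℚ.* (c ℚ.* f i))   ≡⟨ Σ≤-cong n (λ i → x∙yz≈y∙xz (ι (n C i)) c (f i)) ⟩
  Σ≤ n (λ i → c ℚ.* (ι (n C i) ℚ.* f i))   ≡⟨ Σ≤-*ˡ n c _ ⟩
  c ℚ.* T f n                              ≡⟨ κ-⊛ c (T f) n ⟨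
  (κ c ⊛ T f) n                            ∎
  where open ≡-Reasoning

T-𝟙 : T 𝟙 ≈ geom 1ℚ
T-𝟙 n = trans (Σ≤-only-first n _ (λ i → ℚP.*-zeroʳ (ι (n C suc i)))) (sym (1^ℚn≡1 n))

private
  T-Z-⊛-suc′ : ∀ f n → T (Z ⊛ f) (suc n) ≡ Σ≤ n (λ i → ι (suc n C suc i) ℚ.* f i)
  T-Z-⊛-suc′ f n = begin
    T (Z ⊛ f) (suc n)
      ≡⟨ Σ≤-suc-first n _ ⟩
    1ℚ ℚ.* (Z ⊛ f) 0 ℚ.+ Σ≤ n (λ i → ι (suc n C suc i) ℚ.* (Z ⊛ f) (suc i))
      ≡⟨ cong₂ ℚ._+_ (cong (1ℚ ℚ.*_) (Z-⊛-zero f)) (Σ≤-cong n (λ i → cong (ι (suc n C suc i) ℚ.*_) (Z-⊛-suc f i))) ⟩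
    0ℚ ℚ.+ Σ≤ n (λ i → ι (suc n C suc i) ℚ.* f i)
      ≡⟨ ℚP.+-identityˡ _ ⟩
    Σ≤ n (λ i → ι (suc n C suc i) ℚ.* f i) ∎
    where open ≡-Reasoning

  T-Z-⊛ : ∀ f n → T (Z ⊛ f) n ≡ Σ≤ n (λ i → ι (n C suc i) ℚ.* f i)
  T-Z-⊛ f zero    = ℚP.*-identityˡ ((Z ⊛ f) 0)
  T-Z-⊛ f (suc n) = begin
    T (Z ⊛ f) (suc n)
      ≡⟨ T-Z-⊛-suc′ f n ⟩
    Σ≤ n (λ i → ι (suc n C suc i) ℚ.* f i)
      ≡⟨ ℚP.+-identityʳ _ ⟨
    Σ≤ n (λ i → ι (suc n C suc i) ℚ.* f i) ℚ.+ 0ℚ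
      ≡⟨ cong (Σ≤ n (λ i → ι (suc n C suc i) ℚ.* f i) ℚ.+_) last-term≡0 ⟨
    Σ≤ (suc n) (λ i → ι (suc n C suc i) ℚ.* f i) ∎
    where
    open ≡-Reasoning
    last-term≡0 : ι (suc n C suc (suc n)) ℚ.* f (suc n) ≡ 0ℚ
    last-term≡0 = trans (cong (λ k → ι k ℚ.* f (suc n)) (k>n⇒nCk≡0 (ℕP.n<1+n (suc n)))) (ℚP.*-zeroˡ (f (suc n)))

T-Z-⊛-suc : ∀ f n → T (Z ⊛ f) (suc n) ≡ T (Z ⊛ f) n ℚ.+ T f n
T-Z-⊛-suc f n = begin
  T (Z ⊛ f) (suc n)
    ≡⟨ T-Z-⊛-suc′ f n ⟩
  Σ≤ n (λ i → ι (suc n C suc i) ℚ.* f i)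
    ≡⟨ Σ≤-cong n pascal ⟩
  Σ≤ n (λ i → ι (n C i) ℚ.* f i ℚ.+ ι (n C suc i) ℚ.* f i)
    ≡⟨ Σ≤-distrib-+ n _ _ ⟩
  T f n ℚ.+ Σ≤ n (λ i → ι (n C suc i) ℚ.* f i)
    ≡⟨ ℚP.+-comm (T f n) _ ⟩
  Σ≤ n (λ i → ι (n C suc i) ℚ.* f i) ℚ.+ T f n
    ≡⟨ cong (ℚ._+ T f n) (T-Z-⊛ f n) ⟨
  T (Z ⊛ f) n ℚ.+ T f n ∎
  where
  open ≡-Reasoning
  pascal : ∀ i → ι (suc n C suc i) ℚ.* f i ≡ ι (n C i) ℚ.* f i ℚ.+ ι (n C suc i) ℚ.* f i
  pascal i = trans (cong (λ k → ι k ℚ.* f i) (sym (nCk+nC[k+1]≡[n+1]C[k+1] n i)))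
    (trans (cong (ℚ._* f i) (ι-+ (n C i) (n C suc i))) (ℚP.*-distribʳ-+ (f i) (ι (n C i)) (ι (n C suc i))))

[1-z]T[zf]≈zTf : ∀ f → (1- 𝟙 ·Z) ⊛ T (Z ⊛ f) ≈ Z ⊛ T f
[1-z]T[zf]≈zTf f = ≈-modulo 𝟙 (T (Z ⊛ f) -ˢ (Z ⊛ T (Z ⊛ f) +ˢ Z ⊛ T f))
  (solve 3 (λ Z A B → (con 1ℚ :- con 1ℚ :* Z) :* A := Z :* B :+ con 1ℚ :* (A :- (Z :* A :+ Z :* B)))
     ≈-refl Z (T (Z ⊛ f)) (T f))
  (≈⇒difference≈0 T-Z-⊛-unfold)
  where
  T-Z-⊛-unfold : T (Z ⊛ f) ≈ Z ⊛ T (Z ⊛ f) +ˢ Z ⊛ T f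
  T-Z-⊛-unfold zero = trans (trans (ℚP.*-identityˡ _) (Z-⊛-zero f))
    (sym (cong₂ ℚ._+_ (Z-⊛-zero (T (Z ⊛ f))) (Z-⊛-zero (T f))))
  T-Z-⊛-unfold (suc n) =
    trans (T-Z-⊛-suc f n) (sym (cong₂ ℚ._+_ (Z-⊛-suc (T (Z ⊛ f)) n) (Z-⊛-suc (T f) n)))

-- The rational functions U m, W m = U m / (1 - (m+1)z) and V m = (1 + mz) U m

W : ℕ → Series
W m = geom (ι (suc m)) ⊛ U m

V : ℕ → Series
V m = (𝟙 +ˢ κℕ m ⊛ Z) ⊛ U m

[1-[m+1]z]W≈U : ∀ m → (1- κ[1+ m ] ·Z) ⊛ W m ≈ U m
[1-[m+1]z]W≈U m = begin
  (1- κ[1+ m ] ·Z) ⊛ (geom (ι (suc m)) ⊛ U m)   ≈⟨ solve 3 (λ L G U → L :* (G :* U) := (L :* G) :* U) ≈-refl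
                                                        (1- κ[1+ m ] ·Z) (geom (ι (suc m))) (U m) ⟩
  ((1- κ[1+ m ] ·Z) ⊛ geom (ι (suc m))) ⊛ U m   ≈⟨ ⊛-congˡ (U m) ([1-[m+1]z]geom≈1 m) ⟩
  𝟙 ⊛ U m                                       ≈⟨ solve 1 (λ U → con 1ℚ :* U := U) ≈-refl (U m) ⟩
  U m                                           ∎
  where open ≈-Reasoning

W-unfold : ∀ m → W m ≈ U m +ˢ κ[1+ m ] ⊛ (Z ⊛ W m)
W-unfold m = ≈-modulo 𝟙 ((1- κ[1+ m ] ·Z) ⊛ W m -ˢ U m)
  (solve 4 (λ M Z W U → W := (U :+ (con 1ℚ :+ M) :* (Z :* W)) :+ con 1ℚ :* ((con 1ℚ :- (con 1ℚ :+ M) :* Z) :* W :- U))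
     ≈-refl (κℕ m) Z (W m) (U m))
  (≈⇒difference≈0 ([1-[m+1]z]W≈U m))

[1+[m+1]z]U[m+1]≈[m+1]zU : ∀ m → (𝟙 +ˢ κ[1+ m ] ⊛ Z) ⊛ U (suc m) ≈ κ[1+ m ] ⊛ (Z ⊛ U m)
[1+[m+1]z]U[m+1]≈[m+1]zU m = ≈-modulo 𝟙 (U (suc m) -ˢ κ[1+ m ] ⊛ (Z ⊛ (U m -ˢ U (suc m))))
  (solve 4 (λ M Z U U′ → (con 1ℚ :+ (con 1ℚ :+ M) :* Z) :* U′
                      := (con 1ℚ :+ M) :* (Z :* U) :+ con 1ℚ :* (U′ :- (con 1ℚ :+ M) :* (Z :* (U :- U′))))
     ≈-refl (κℕ m) Z (U m) (U (suc m)))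
  (≈⇒difference≈0 (≈-trans (U-suc m) (⊛-congˡ (Z ⊛ (U m -ˢ U (suc m))) (κℕ-suc m))))

V-suc : ∀ m → V (suc m) ≈ κ[1+ m ] ⊛ (Z ⊛ U m)
V-suc m = ≈-trans (⊛-congˡ (U (suc m)) (+ˢ-congʳ 𝟙 (⊛-congˡ Z (κℕ-suc m)))) ([1+[m+1]z]U[m+1]≈[m+1]zU m)

[1+mz]TU[m+1]≈[m+1]zTU : ∀ m → (𝟙 +ˢ κℕ m ⊛ Z) ⊛ T (U (suc m)) ≈ κ[1+ m ] ⊛ (Z ⊛ T (U m))
[1+mz]TU[m+1]≈[m+1]zTU m = ≈-modulo 𝟙 ((1- 𝟙 ·Z) ⊛ TU′ -ˢ κ[1+ m ] ⊛ (Z ⊛ (TU -ˢ TU′)))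
  (solve 4 (λ M Z A A′ → (con 1ℚ :+ M :* Z) :* A′
                      := (con 1ℚ :+ M) :* (Z :* A) :+ con 1ℚ :* ((con 1ℚ :- con 1ℚ :* Z) :* A′ :- (con 1ℚ :+ M) :* (Z :* (A :- A′))))
     ≈-refl (κℕ m) Z TU TU′)
  (≈⇒difference≈0 [1-z]TU′≈[m+1]z[TU-TU′])
  where
  TU = T (U m)
  TU′ = T (U (suc m))
  [1-z]TU′≈[m+1]z[TU-TU′] : (1- 𝟙 ·Z) ⊛ TU′ ≈ κ[1+ m ] ⊛ (Z ⊛ (TU -ˢ TU′))
  [1-z]TU′≈[m+1]z[TU-TU′] = begin
    (1- 𝟙 ·Z) ⊛ TU′
      ≈⟨ ⊛-congʳ (1- 𝟙 ·Z) (T-cong (U-suc m)) ⟩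
    (1- 𝟙 ·Z) ⊛ T (κℕ (suc m) ⊛ (Z ⊛ (U m -ˢ U (suc m))))
      ≈⟨ ⊛-congʳ (1- 𝟙 ·Z) (≈-trans (T-κ-⊛ (ι (suc m)) (Z ⊛ (U m -ˢ U (suc m))))
                                    (⊛-congˡ (T (Z ⊛ (U m -ˢ U (suc m)))) (κℕ-suc m))) ⟩
    (1- 𝟙 ·Z) ⊛ (κ[1+ m ] ⊛ T (Z ⊛ (U m -ˢ U (suc m))))
      ≈⟨ solve 3 (λ L C A → L :* (C :* A) := C :* (L :* A)) ≈-refl (1- 𝟙 ·Z) κ[1+ m ] (T (Z ⊛ (U m -ˢ U (suc m)))) ⟩
    κ[1+ m ] ⊛ ((1- 𝟙 ·Z) ⊛ T (Z ⊛ (U m -ˢ U (suc m))))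
      ≈⟨ ⊛-congʳ κ[1+ m ] ([1-z]T[zf]≈zTf (U m -ˢ U (suc m))) ⟩
    κ[1+ m ] ⊛ (Z ⊛ T (U m -ˢ U (suc m)))
      ≈⟨ ⊛-congʳ κ[1+ m ] (⊛-congʳ Z (≈-trans (T-+ (U m) (-ˢ U (suc m))) (+ˢ-congʳ TU (T-neg (U (suc m)))))) ⟩
    κ[1+ m ] ⊛ (Z ⊛ (TU -ˢ TU′)) ∎
    where open ≈-Reasoning

[1-z]TU≈V : ∀ m → (1- 𝟙 ·Z) ⊛ T (U m) ≈ V m
[1-z]TU≈V zero = begin
  (1- 𝟙 ·Z) ⊛ T (U 0)        ≈⟨ ⊛-congʳ (1- 𝟙 ·Z) (≈-trans (T-cong U-zero) T-𝟙) ⟩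
  (1- 𝟙 ·Z) ⊛ geom 1ℚ        ≈⟨ [1-cz]geom≈1 1ℚ ⟩
  𝟙                          ≈⟨ solve 1 (λ Z → con 1ℚ := (con 1ℚ :+ con 0ℚ :* Z) :* con 1ℚ) ≈-refl Z ⟩
  (𝟙 +ˢ κℕ 0 ⊛ Z) ⊛ 𝟙        ≈⟨ ⊛-congʳ (𝟙 +ˢ κℕ 0 ⊛ Z) (≈-sym U-zero) ⟩
  V 0                        ∎
  where open ≈-Reasoning
[1-z]TU≈V (suc m) = ⊛-cancelˡ-invertible (𝟙 +ˢ κℕ m ⊛ Z) (geom (ℚ.- ι m)) _ _ ([1+mz]geom[-m]≈1 m) (begin
  e ⊛ ((1- 𝟙 ·Z) ⊛ TU′)                     ≈⟨ solve 3 (λ E L A → E :* (L :* A) := L :* (E :* A)) ≈-refl e (1- 𝟙 ·Z) TU′ ⟩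
  (1- 𝟙 ·Z) ⊛ (e ⊛ TU′)                     ≈⟨ ⊛-congʳ (1- 𝟙 ·Z) ([1+mz]TU[m+1]≈[m+1]zTU m) ⟩
  (1- 𝟙 ·Z) ⊛ (κ[1+ m ] ⊛ (Z ⊛ T (U m)))    ≈⟨ solve 4 (λ L C Z A → L :* (C :* (Z :* A)) := C :* (Z :* (L :* A)))
                                                  ≈-refl (1- 𝟙 ·Z) κ[1+ m ] Z (T (U m)) ⟩
  κ[1+ m ] ⊛ (Z ⊛ ((1- 𝟙 ·Z) ⊛ T (U m)))    ≈⟨ ⊛-congʳ κ[1+ m ] (⊛-congʳ Z ([1-z]TU≈V m)) ⟩
  κ[1+ m ] ⊛ (Z ⊛ (e ⊛ U m))                ≈⟨ solve 4 (λ C Z E U → C :* (Z :* (E :* U)) := E :* (C :* (Z :* U)))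
                                                  ≈-refl κ[1+ m ] Z e (U m) ⟩
  e ⊛ (κ[1+ m ] ⊛ (Z ⊛ U m))                ≈⟨ ⊛-congʳ e (V-suc m) ⟨
  e ⊛ V (suc m)                             ∎)
  where
  open ≈-Reasoning
  e = 𝟙 +ˢ κℕ m ⊛ Z
  TU′ = T (U (suc m))

[1-[m+2]z]TW≈V : ∀ m → (1- 𝟙 +ˢ κ[1+ m ] ·Z) ⊛ T (W m) ≈ V m
[1-[m+2]z]TW≈V m = begin
  (1- 𝟙 +ˢ κ[1+ m ] ·Z) ⊛ TW
    ≈⟨ solve 3 (λ M Z A → (con 1ℚ :- (con 1ℚ :+ (con 1ℚ :+ M)) :* Z) :* A
                       := (con 1ℚ :- con 1ℚ :* Z) :* A :- (con 1ℚ :+ M) :* (Z :* A)) ≈-refl (κℕ m) Z TW ⟩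
  (1- 𝟙 ·Z) ⊛ TW -ˢ κ[1+ m ] ⊛ (Z ⊛ TW)
    ≈⟨ +ˢ-congˡ (-ˢ (κ[1+ m ] ⊛ (Z ⊛ TW))) (⊛-congʳ (1- 𝟙 ·Z) TW-unfold) ⟩
  (1- 𝟙 ·Z) ⊛ (T (U m) +ˢ κ[1+ m ] ⊛ T (Z ⊛ W m)) -ˢ κ[1+ m ] ⊛ (Z ⊛ TW)
    ≈⟨ solve 5 (λ L C A B D → L :* (A :+ C :* B) :- C :* D := L :* A :+ C :* (L :* B) :- C :* D)
         ≈-refl (1- 𝟙 ·Z) κ[1+ m ] (T (U m)) (T (Z ⊛ W m)) (Z ⊛ TW) ⟩
  (1- 𝟙 ·Z) ⊛ T (U m) +ˢ κ[1+ m ] ⊛ ((1- 𝟙 ·Z) ⊛ T (Z ⊛ W m)) -ˢ κ[1+ m ] ⊛ (Z ⊛ TW)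
    ≈⟨ +ˢ-congˡ (-ˢ (κ[1+ m ] ⊛ (Z ⊛ TW))) (+ˢ-cong ([1-z]TU≈V m) (⊛-congʳ κ[1+ m ] ([1-z]T[zf]≈zTf (W m)))) ⟩
  V m +ˢ κ[1+ m ] ⊛ (Z ⊛ TW) -ˢ κ[1+ m ] ⊛ (Z ⊛ TW)
    ≈⟨ solve 2 (λ A B → A :+ B :- B := A) ≈-refl (V m) (κ[1+ m ] ⊛ (Z ⊛ TW)) ⟩
  V m ∎
  where
  open ≈-Reasoning
  TW = T (W m)
  TW-unfold : TW ≈ T (U m) +ˢ κ[1+ m ] ⊛ T (Z ⊛ W m)
  TW-unfold = ≈-trans (T-cong (W-unfold m)) (≈-trans (T-+ (U m) (κ[1+ m ] ⊛ (Z ⊛ W m)))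
    (+ˢ-congʳ (T (U m)) (≈-trans (T-cong (⊛-congˡ (Z ⊛ W m) (≈-sym (κℕ-suc m))))
      (≈-trans (T-κ-⊛ (ι (suc m)) (Z ⊛ W m)) (⊛-congˡ (T (Z ⊛ W m)) (κℕ-suc m))))))

E : ℕ → Series
E m = κℕ 4 ⊛ W m -ˢ κℕ 2 ⊛ (Z ⊛ W m) -ˢ T (W m)

g : ℕ → Series
g m = ((κℕ 3 -ˢ (κℕ m +ˢ κℕ 3) ⊛ Z) ⊛ V m) ⊛ geom (ι (suc m))

g-suc : ∀ m → g (suc m) ≈ ((κℕ 3 -ˢ (κ[1+ m ] +ˢ κℕ 3) ⊛ Z) ⊛ (κ[1+ m ] ⊛ (Z ⊛ U m))) ⊛ geom (ι (2 ℕ.+ m))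
g-suc m = ⊛-congˡ (geom (ι (2 ℕ.+ m)))
  (⊛-cong (+ˢ-congʳ (κℕ 3) (-ˢ-cong (⊛-congˡ Z (+ˢ-congˡ (κℕ 3) (κℕ-suc m))))) (V-suc m))

[1-z]E≈g-g[m+1] : ∀ m → (1- 𝟙 ·Z) ⊛ E m ≈ g m -ˢ g (suc m)
[1-z]E≈g-g[m+1] m = ⊛-cancelˡ-invertible (l₁ ⊛ l₂) (G₁ ⊛ G₂) _ _ l₁l₂G₁G₂≈1 (begin
  (l₁ ⊛ l₂) ⊛ ((1- 𝟙 ·Z) ⊛ E m)
    ≈⟨ solve 4 (λ M Z W TW →
         let l = con 1ℚ :- con 1ℚ :* Z
             l₁ = con 1ℚ :- (con 1ℚ :+ M) :* Z
             l₂ = con 1ℚ :- (con 1ℚ :+ (con 1ℚ :+ M)) :* Z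
         in (l₁ :* l₂) :* (l :* (con (ι 4) :* W :- con (ι 2) :* (Z :* W) :- TW))
            := (l :* (con (ι 4) :- con (ι 2) :* Z)) :* (l₂ :* (l₁ :* W)) :- (l :* l₁) :* (l₂ :* TW))
         ≈-refl (κℕ m) Z (W m) (T (W m)) ⟩
  ((1- 𝟙 ·Z) ⊛ (κℕ 4 -ˢ κℕ 2 ⊛ Z)) ⊛ (l₂ ⊛ (l₁ ⊛ W m)) -ˢ ((1- 𝟙 ·Z) ⊛ l₁) ⊛ (l₂ ⊛ T (W m))
    ≈⟨ +ˢ-cong (⊛-congʳ ((1- 𝟙 ·Z) ⊛ (κℕ 4 -ˢ κℕ 2 ⊛ Z)) (⊛-congʳ l₂ ([1-[m+1]z]W≈U m)))
               (-ˢ-cong (⊛-congʳ ((1- 𝟙 ·Z) ⊛ l₁) ([1-[m+2]z]TW≈V m))) ⟩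
  ((1- 𝟙 ·Z) ⊛ (κℕ 4 -ˢ κℕ 2 ⊛ Z)) ⊛ (l₂ ⊛ U m) -ˢ ((1- 𝟙 ·Z) ⊛ l₁) ⊛ V m
    ≈⟨ solve 3 (λ M Z U →
         let l = con 1ℚ :- con 1ℚ :* Z
             c = con 1ℚ :+ M
             l₁ = con 1ℚ :- c :* Z
             l₂ = con 1ℚ :- (con 1ℚ :+ c) :* Z
             V = (con 1ℚ :+ M :* Z) :* U
         in (l :* (con (ι 4) :- con (ι 2) :* Z)) :* (l₂ :* U) :- (l :* l₁) :* V
            := l₂ :* ((con (ι 3) :- (M :+ con (ι 3)) :* Z) :* V)
               :- l₁ :* ((con (ι 3) :- (c :+ con (ι 3)) :* Z) :* (c :* (Z :* U))))
         ≈-refl (κℕ m) Z (U m) ⟩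
  l₂ ⊛ A -ˢ l₁ ⊛ B
    ≈⟨ solve 4 (λ l₁ l₂ A B → l₂ :* A :- l₁ :* B := (l₂ :* A) :* con 1ℚ :- (l₁ :* B) :* con 1ℚ) ≈-refl l₁ l₂ A B ⟩
  (l₂ ⊛ A) ⊛ 𝟙 -ˢ (l₁ ⊛ B) ⊛ 𝟙
    ≈⟨ +ˢ-cong (⊛-congʳ (l₂ ⊛ A) ([1-[m+1]z]geom≈1 m)) (-ˢ-cong (⊛-congʳ (l₁ ⊛ B) ([1-[m+2]z]geom≈1 m))) ⟨
  (l₂ ⊛ A) ⊛ (l₁ ⊛ G₁) -ˢ (l₁ ⊛ B) ⊛ (l₂ ⊛ G₂)
    ≈⟨ solve 6 (λ l₁ l₂ A B G₁ G₂ → (l₂ :* A) :* (l₁ :* G₁) :- (l₁ :* B) :* (l₂ :* G₂)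
                                  := (l₁ :* l₂) :* (A :* G₁ :- B :* G₂)) ≈-refl l₁ l₂ A B G₁ G₂ ⟩
  (l₁ ⊛ l₂) ⊛ (A ⊛ G₁ -ˢ B ⊛ G₂)
    ≈⟨ ⊛-congʳ (l₁ ⊛ l₂) (+ˢ-congʳ (g m) (-ˢ-cong (g-suc m))) ⟨
  (l₁ ⊛ l₂) ⊛ (g m -ˢ g (suc m)) ∎)
  where
  open ≈-Reasoning
  l₁ = 1- κ[1+ m ] ·Z
  l₂ = 1- 𝟙 +ˢ κ[1+ m ] ·Z
  G₁ = geom (ι (suc m))
  G₂ = geom (ι (2 ℕ.+ m))
  A = (κℕ 3 -ˢ (κℕ m +ˢ κℕ 3) ⊛ Z) ⊛ V m
  B = (κℕ 3 -ˢ (κ[1+ m ] +ˢ κℕ 3) ⊛ Z) ⊛ (κ[1+ m ] ⊛ (Z ⊛ U m))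
  l₁l₂G₁G₂≈1 : (l₁ ⊛ l₂) ⊛ (G₁ ⊛ G₂) ≈ 𝟙
  l₁l₂G₁G₂≈1 = begin
    (l₁ ⊛ l₂) ⊛ (G₁ ⊛ G₂)    ≈⟨ solve 4 (λ a b c d → (a :* b) :* (c :* d) := (a :* c) :* (b :* d)) ≈-refl l₁ l₂ G₁ G₂ ⟩
    (l₁ ⊛ G₁) ⊛ (l₂ ⊛ G₂)    ≈⟨ ⊛-cong ([1-[m+1]z]geom≈1 m) ([1-[m+2]z]geom≈1 m) ⟩
    𝟙 ⊛ 𝟙                    ≈⟨ solve 0 (con 1ℚ :* con 1ℚ := con 1ℚ) ≈-refl ⟩
    𝟙                        ∎

VanishesBelow-⊛ : ∀ m a f → VanishesBelow m f → VanishesBelow m (a ⊛ f)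
VanishesBelow-⊛ m a f f≡0 i i<m = Σ≤-zero i _ (λ k k≤i →
  trans (cong (a k ℚ.*_) (f≡0 (i ℕ.∸ k) (ℕP.≤-<-trans (ℕP.m∸n≤m i k) i<m))) (ℚP.*-zeroʳ (a k)))

VanishesBelow-⊛′ : ∀ m a f → VanishesBelow m f → VanishesBelow m (f ⊛ a)
VanishesBelow-⊛′ m a f f≡0 i i<m = trans (⊛-comm f a i) (VanishesBelow-⊛ m a f f≡0 i i<m)

VanishesBelow-sub : ∀ m f g → VanishesBelow m f → VanishesBelow m g → VanishesBelow m (f -ˢ g)
VanishesBelow-sub m f g f≡0 g≡0 i i<m = cong₂ ℚ._-_ (f≡0 i i<m) (g≡0 i i<m)

VanishesBelow-T : ∀ m f → VanishesBelow m f → VanishesBelow m (T f)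
VanishesBelow-T m f f≡0 i i<m = Σ≤-zero i _ (λ k k≤i →
  trans (cong (ι (i C k) ℚ.*_) (f≡0 k (ℕP.≤-<-trans k≤i i<m))) (ℚP.*-zeroʳ (ι (i C k))))

W-vanishes : ∀ m → VanishesBelow m (W m)
W-vanishes m = VanishesBelow-⊛ m (geom (ι (suc m))) (U m) (U-vanishes m)

E-vanishes : ∀ m → VanishesBelow m (E m)
E-vanishes m = VanishesBelow-sub m _ _
  (VanishesBelow-sub m _ _ (VanishesBelow-⊛ m (κℕ 4) (W m) (W-vanishes m))
                         (VanishesBelow-⊛ m (κℕ 2) (Z ⊛ W m) (VanishesBelow-⊛ m Z (W m) (W-vanishes m))))
  (VanishesBelow-T m (W m) (W-vanishes m))

g-vanishes : ∀ m → VanishesBelow m (g m)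
g-vanishes m = VanishesBelow-⊛′ m (geom (ι (suc m))) _
  (VanishesBelow-⊛ m (κℕ 3 -ˢ (κℕ m +ˢ κℕ 3) ⊛ Z) (V m) (VanishesBelow-⊛ m (𝟙 +ˢ κℕ m ⊛ Z) (U m) (U-vanishes m)))

g-zero : g 0 ≈ κℕ 3
g-zero = begin
  g 0
    ≈⟨ solve 3 (λ Z U G → ((con (ι 3) :- (con (ι 0) :+ con (ι 3)) :* Z) :* ((con 1ℚ :+ con (ι 0) :* Z) :* U)) :* G
                        := con (ι 3) :* (((con 1ℚ :- (con 1ℚ :+ con (ι 0)) :* Z) :* G) :* U))
         ≈-refl Z (U 0) (geom (ι 1)) ⟩
  κℕ 3 ⊛ (((1- κ[1+ 0 ] ·Z) ⊛ geom (ι 1)) ⊛ U 0)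
    ≈⟨ ⊛-congʳ (κℕ 3) (⊛-cong ([1-[m+1]z]geom≈1 0) U-zero) ⟩
  κℕ 3 ⊛ (𝟙 ⊛ 𝟙)
    ≈⟨ solve 0 (con (ι 3) :* (con 1ℚ :* con 1ℚ) := con (ι 3)) ≈-refl ⟩
  κℕ 3 ∎
  where open ≈-Reasoning

[1-z]f-coefficient : ∀ f n → ((1- 𝟙 ·Z) ⊛ f) n ≡ f n ℚ.- (Z ⊛ f) n
[1-z]f-coefficient f = solve 2 (λ Z f → (con 1ℚ :- con 1ℚ :* Z) :* f := f :- Z :* f) ≈-refl Z f

Σ[1-z]E≡3 : ∀ n → Σ≤ n (λ m → ((1- 𝟙 ·Z) ⊛ E m) n) ≡ κℕ 3 n
Σ[1-z]E≡3 n = begin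
  Σ≤ n (λ m → ((1- 𝟙 ·Z) ⊛ E m) n)   ≡⟨ Σ≤-cong n (λ m → [1-z]E≈g-g[m+1] m n) ⟩
  Σ≤ n (λ m → g m n ℚ.- g (suc m) n)  ≡⟨ Σ≤-telescope n (λ m → g m n) ⟩
  g 0 n ℚ.- g (suc n) n               ≡⟨ cong (λ x → g 0 n ℚ.- x) (g-vanishes (suc n) n ℕP.≤-refl) ⟩
  g 0 n ℚ.- 0ℚ                        ≡⟨ ℚP.+-identityʳ (g 0 n) ⟩
  g 0 n                               ≡⟨ g-zero n ⟩
  κℕ 3 n                              ∎
  where open ≡-Reasoning

ΣE≡3 : ∀ n → Σ≤ n (λ m → E m n) ≡ ι 3
ΣE≡3 zero    = trans (sym (trans ([1-z]f-coefficient (E 0) 0)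
                  (trans (cong (λ x → E 0 0 ℚ.- x) (Z-⊛-zero (E 0))) (ℚP.+-identityʳ (E 0 0)))))
                  (Σ[1-z]E≡3 0)
ΣE≡3 (suc n) = begin
  Σ≤ (suc n) (λ m → E m (suc n))
    ≡⟨ ℚS.solve 2 (λ a b → a ℚS.:= (a ℚS.:- b) ℚS.:+ b) refl (Σ≤ (suc n) (λ m → E m (suc n))) (Σ≤ (suc n) (λ m → E m n)) ⟩
  (Σ≤ (suc n) (λ m → E m (suc n)) ℚ.- Σ≤ (suc n) (λ m → E m n)) ℚ.+ Σ≤ (suc n) (λ m → E m n)
    ≡⟨ cong₂ ℚ._+_ difference≡0 last-term-vanishes ⟩
  0ℚ ℚ.+ (Σ≤ n (λ m → E m n) ℚ.+ 0ℚ)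
    ≡⟨ trans (ℚP.+-identityˡ _) (ℚP.+-identityʳ _) ⟩
  Σ≤ n (λ m → E m n)
    ≡⟨ ΣE≡3 n ⟩
  ι 3 ∎
  where
  open ≡-Reasoning
  last-term-vanishes : Σ≤ (suc n) (λ m → E m n) ≡ Σ≤ n (λ m → E m n) ℚ.+ 0ℚ
  last-term-vanishes = cong (Σ≤ n (λ m → E m n) ℚ.+_) (E-vanishes (suc n) n ℕP.≤-refl)
  difference≡0 : Σ≤ (suc n) (λ m → E m (suc n)) ℚ.- Σ≤ (suc n) (λ m → E m n) ≡ 0ℚ
  difference≡0 = begin
    Σ≤ (suc n) (λ m → E m (suc n)) ℚ.- Σ≤ (suc n) (λ m → E m n)
      ≡⟨ cong (Σ≤ (suc n) (λ m → E m (suc n)) ℚ.+_) (Σ≤-neg (suc n) (λ m → E m n)) ⟨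
    Σ≤ (suc n) (λ m → E m (suc n)) ℚ.+ Σ≤ (suc n) (λ m → ℚ.- E m n)
      ≡⟨ Σ≤-distrib-+ (suc n) (λ m → E m (suc n)) (λ m → ℚ.- E m n) ⟨
    Σ≤ (suc n) (λ m → E m (suc n) ℚ.- E m n)
      ≡⟨ Σ≤-cong (suc n) (λ m → trans ([1-z]f-coefficient (E m) (suc n)) (cong (λ x → E m (suc n) ℚ.- x) (Z-⊛-suc (E m) n))) ⟨
    Σ≤ (suc n) (λ m → ((1- 𝟙 ·Z) ⊛ E m) (suc n))
      ≡⟨ Σ[1-z]E≡3 (suc n) ⟩
    0ℚ ∎

A : Series
A n = Σ≤ n (λ m → W m n)

Σ≤-Z-⊛-W : ∀ n → Σ≤ n (λ m → (Z ⊛ W m) n) ≡ (Z ⊛ A) n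
Σ≤-Z-⊛-W zero    = trans (Z-⊛-zero (W 0)) (sym (Z-⊛-zero A))
Σ≤-Z-⊛-W (suc n) = begin
  Σ≤ (suc n) (λ m → (Z ⊛ W m) (suc n))   ≡⟨ Σ≤-cong (suc n) (λ m → Z-⊛-suc (W m) n) ⟩
  A n ℚ.+ W (suc n) n                    ≡⟨ cong (A n ℚ.+_) (W-vanishes (suc n) n ℕP.≤-refl) ⟩
  A n ℚ.+ 0ℚ                             ≡⟨ ℚP.+-identityʳ (A n) ⟩
  A n                                    ≡⟨ Z-⊛-suc A n ⟨
  (Z ⊛ A) (suc n)                        ∎
  where open ≡-Reasoning

Σ≤-T-W : ∀ n → Σ≤ n (λ m → T (W m) n) ≡ T A n
Σ≤-T-W n = trans (Σ≤-swap n n (λ m i → ι (n C i) ℚ.* W m i)) (Σ≤-cong-≤ n (λ i i≤n →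
  trans (Σ≤-*ˡ n (ι (n C i)) (λ m → W m i))
        (cong (ι (n C i) ℚ.*_) (Σ≤-truncate n i (λ m → W m i) i≤n (λ m i<m → W-vanishes m i i<m)))))

A-recurrence : ∀ n → ι 4 ℚ.* A n ℚ.- ι 2 ℚ.* (Z ⊛ A) n ℚ.- T A n ≡ ι 3
A-recurrence n = begin
  ι 4 ℚ.* A n ℚ.- ι 2 ℚ.* (Z ⊛ A) n ℚ.- T A n
    ≡⟨ cong₂ (λ a b → a ℚ.- b ℚ.- T A n) (Σ≤-*ˡ n (ι 4) (λ m → W m n))
             (trans (Σ≤-*ˡ n (ι 2) (λ m → (Z ⊛ W m) n)) (cong (ι 2 ℚ.*_) (Σ≤-Z-⊛-W n))) ⟨
  Σ≤ n (λ m → ι 4 ℚ.* W m n) ℚ.- Σ≤ n (λ m → ι 2 ℚ.* (Z ⊛ W m) n) ℚ.- T A n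
    ≡⟨ cong (ℚ._- T A n) (trans (Σ≤-distrib-+ n (λ m → ι 4 ℚ.* W m n) (λ m → ℚ.- (ι 2 ℚ.* (Z ⊛ W m) n)))
                                 (cong (Σ≤ n (λ m → ι 4 ℚ.* W m n) ℚ.+_) (Σ≤-neg n (λ m → ι 2 ℚ.* (Z ⊛ W m) n)))) ⟨
  Σ≤ n (λ m → ι 4 ℚ.* W m n ℚ.- ι 2 ℚ.* (Z ⊛ W m) n) ℚ.- T A n
    ≡⟨ cong (λ x → Σ≤ n (λ m → ι 4 ℚ.* W m n ℚ.- ι 2 ℚ.* (Z ⊛ W m) n) ℚ.- x) (Σ≤-T-W n) ⟨
  Σ≤ n (λ m → ι 4 ℚ.* W m n ℚ.- ι 2 ℚ.* (Z ⊛ W m) n) ℚ.- Σ≤ n (λ m → T (W m) n)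
    ≡⟨ cong (Σ≤ n (λ m → ι 4 ℚ.* W m n ℚ.- ι 2 ℚ.* (Z ⊛ W m) n) ℚ.+_) (Σ≤-neg n (λ m → T (W m) n)) ⟨
  Σ≤ n (λ m → ι 4 ℚ.* W m n ℚ.- ι 2 ℚ.* (Z ⊛ W m) n) ℚ.+ Σ≤ n (λ m → ℚ.- T (W m) n)
    ≡⟨ Σ≤-distrib-+ n (λ m → ι 4 ℚ.* W m n ℚ.- ι 2 ℚ.* (Z ⊛ W m) n) (λ m → ℚ.- T (W m) n) ⟨
  Σ≤ n (λ m → ι 4 ℚ.* W m n ℚ.- ι 2 ℚ.* (Z ⊛ W m) n ℚ.- T (W m) n)
    ≡⟨ Σ≤-cong n (λ m → cong₂ (λ a b → a ℚ.- b ℚ.- T (W m) n) (κ-⊛ (ι 4) (W m) n) (κ-⊛ (ι 2) (Z ⊛ W m) n)) ⟨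
  Σ≤ n (λ m → E m n)
    ≡⟨ ΣE≡3 n ⟩
  ι 3 ∎
  where open ≡-Reasoning

rhs≡A : ∀ n → Σ≤ n (λ k → polyBernoulliNeg (n ℕ.∸ k) k) ≡ A n
rhs≡A n = begin
  Σ≤ n (λ k → polyBernoulliNeg (n ℕ.∸ k) k)
    ≡⟨ Σ≤-cong n (λ k → trans (sym (Σ≤-*ˡ (n ℕ.∸ k) (ι ((n ℕ.∸ k) !)) _)) (Σ≤-cong (n ℕ.∸ k) (term k))) ⟩
  Σ≤ n (λ k → Σ≤ (n ℕ.∸ k) (λ m → h k m))
    ≡⟨ Σ≤-cong-≤ n (λ k k≤n → sym (Σ≤-truncate n (n ℕ.∸ k) (h k) (ℕP.m∸n≤m n k) (λ m n∸k<m →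
         trans (cong (geom (ι (suc m)) k ℚ.*_) (U-vanishes m (n ℕ.∸ k) n∸k<m)) (ℚP.*-zeroʳ (geom (ι (suc m)) k))))) ⟩
  Σ≤ n (λ k → Σ≤ n (λ m → h k m))
    ≡⟨ Σ≤-swap n n h ⟩
  A n ∎
  where
  open ≡-Reasoning
  h : ℕ → ℕ → ℚ
  h k m = geom (ι (suc m)) k ℚ.* U m (n ℕ.∸ k)
  term : ∀ k m → ι ((n ℕ.∸ k) !) ℚ.* (ι (suc m ℕ.^ k) ℚ.* upow m (n ℕ.∸ k)) ≡ h k m
  term k m = trans (cong (λ x → ι ((n ℕ.∸ k) !) ℚ.* (x ℚ.* upow m (n ℕ.∸ k))) (ι-^ (suc m) k))
                   (x∙yz≈y∙xz (ι ((n ℕ.∸ k) !)) (ι (suc m) ^ℚ k) (upow m (n ℕ.∸ k)))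

-- Polynomials evaluated at x = e^t/4

1/ι!-suc : ∀ n → ι (suc n) ℚ.* 1/ι! (suc n) ≡ 1/ι! n
1/ι!-suc n = *-cancelʳ-ι (n !) {{n !≢0}} (begin
  (ι (suc n) ℚ.* 1/ι! (suc n)) ℚ.* ι (n !)   ≡⟨ xy∙z≈y∙xz (ι (suc n)) (1/ι! (suc n)) (ι (n !)) ⟩
  1/ι! (suc n) ℚ.* (ι (suc n) ℚ.* ι (n !))   ≡⟨ cong (1/ι! (suc n) ℚ.*_) (ι-! n) ⟨
  1/ι! (suc n) ℚ.* ι (suc n !)               ≡⟨ 1/ι!-inverse (suc n) ⟩
  1ℚ                                         ≡⟨ 1/ι!-inverse n ⟨
  1/ι! n ℚ.* ι (n !)                         ∎)
  where open ≡-Reasoning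

x̂ : Series
x̂ n = + 1 / 4 ℚ.* 1/ι! n

D-x̂ : D x̂ ≈ x̂
D-x̂ n = trans (x∙yz≈y∙xz (ι (suc n)) (+ 1 / 4) (1/ι! (suc n))) (cong (+ 1 / 4 ℚ.*_) (1/ι!-suc n))

⟦_⟧ : Poly → Series
⟦ [] ⟧    = κ 0ℚ
⟦ a ∷ p ⟧ = κ (ιℤ a) +ˢ x̂ ⊛ ⟦ p ⟧

⟦⟧-at-0 : ∀ p → ⟦ p ⟧ 0 ≡ eval p (+ 1 / 4)
⟦⟧-at-0 []      = refl
⟦⟧-at-0 (a ∷ p) = cong (λ y → ιℤ a ℚ.+ + 1 / 4 ℚ.* y) (⟦⟧-at-0 p)

⟦⟧-⊕ : ∀ p q → ⟦ p ⊕ q ⟧ ≈ ⟦ p ⟧ +ˢ ⟦ q ⟧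
⟦⟧-⊕ []      q       = solve 1 (λ q → q := con 0ℚ :+ q) ≈-refl ⟦ q ⟧
⟦⟧-⊕ (a ∷ p) []      = solve 1 (λ p → p := p :+ con 0ℚ) ≈-refl ⟦ a ∷ p ⟧
⟦⟧-⊕ (a ∷ p) (b ∷ q) = ≈-trans
  (+ˢ-cong (≈-trans (κ-cong (ιℤ-+ a b)) (κ-+ (ιℤ a) (ιℤ b))) (⊛-congʳ x̂ (⟦⟧-⊕ p q)))
  (solve 5 (λ a b x p q → (a :+ b) :+ x :* (p :+ q) := (a :+ x :* p) :+ (b :+ x :* q))
     ≈-refl (κ (ιℤ a)) (κ (ιℤ b)) x̂ ⟦ p ⟧ ⟦ q ⟧)

⟦⟧-scale : ∀ c p → ⟦ scale c p ⟧ ≈ κ (ιℤ c) ⊛ ⟦ p ⟧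
⟦⟧-scale c []      = solve 1 (λ c → con 0ℚ := c :* con 0ℚ) ≈-refl (κ (ιℤ c))
⟦⟧-scale c (a ∷ p) = ≈-trans
  (+ˢ-cong (≈-trans (κ-cong (ιℤ-* c a)) (κ-* (ιℤ c) (ιℤ a))) (⊛-congʳ x̂ (⟦⟧-scale c p)))
  (solve 4 (λ c a x p → c :* a :+ x :* (c :* p) := c :* (a :+ x :* p)) ≈-refl (κ (ιℤ c)) (κ (ιℤ a)) x̂ ⟦ p ⟧)

⟦⟧-mulX : ∀ p → ⟦ mulX p ⟧ ≈ x̂ ⊛ ⟦ p ⟧
⟦⟧-mulX p = solve 2 (λ x p → con 0ℚ :+ x :* p := x :* p) ≈-refl x̂ ⟦ p ⟧

D-⟦∷⟧ : ∀ a p → D ⟦ a ∷ p ⟧ ≈ x̂ ⊛ ⟦ p ⟧ +ˢ x̂ ⊛ D ⟦ p ⟧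
D-⟦∷⟧ a p = begin
  D (κ (ιℤ a) +ˢ x̂ ⊛ ⟦ p ⟧)
    ≈⟨ D-+ (κ (ιℤ a)) (x̂ ⊛ ⟦ p ⟧) ⟩
  D (κ (ιℤ a)) +ˢ D (x̂ ⊛ ⟦ p ⟧)
    ≈⟨ +ˢ-cong (D-κ (ιℤ a)) (D-Leibniz x̂ ⟦ p ⟧) ⟩
  κ 0ℚ +ˢ (D x̂ ⊛ ⟦ p ⟧ +ˢ x̂ ⊛ D ⟦ p ⟧)
    ≈⟨ +ˢ-congʳ (κ 0ℚ) (+ˢ-congˡ (x̂ ⊛ D ⟦ p ⟧) (⊛-congˡ ⟦ p ⟧ D-x̂)) ⟩
  κ 0ℚ +ˢ (x̂ ⊛ ⟦ p ⟧ +ˢ x̂ ⊛ D ⟦ p ⟧)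
    ≈⟨ solve 1 (λ y → con 0ℚ :+ y := y) ≈-refl (x̂ ⊛ ⟦ p ⟧ +ˢ x̂ ⊛ D ⟦ p ⟧) ⟩
  x̂ ⊛ ⟦ p ⟧ +ˢ x̂ ⊛ D ⟦ p ⟧ ∎
  where open ≈-Reasoning

-- derivFrom i p is the derivative of x^i p(x), divided by x^(i-1).
⟦⟧-derivFrom : ∀ i p → ⟦ derivFrom i p ⟧ ≈ κℕ i ⊛ ⟦ p ⟧ +ˢ D ⟦ p ⟧
⟦⟧-derivFrom i []      = ≈-trans (solve 1 (λ c → con 0ℚ := c :* con 0ℚ :+ con 0ℚ) ≈-refl (κℕ i))
                                  (+ˢ-congʳ (κℕ i ⊛ κ 0ℚ) (≈-sym (D-κ 0ℚ)))
⟦⟧-derivFrom i (a ∷ p) = begin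
  κ (ιℤ (+ i ℤ.* a)) +ˢ x̂ ⊛ ⟦ derivFrom (suc i) p ⟧
    ≈⟨ +ˢ-cong (≈-trans (κ-cong (ιℤ-* (+ i) a)) (κ-* (ι i) (ιℤ a))) (⊛-congʳ x̂ (⟦⟧-derivFrom (suc i) p)) ⟩
  κℕ i ⊛ κ (ιℤ a) +ˢ x̂ ⊛ (κℕ (suc i) ⊛ ⟦ p ⟧ +ˢ D ⟦ p ⟧)
    ≈⟨ +ˢ-congʳ (κℕ i ⊛ κ (ιℤ a)) (⊛-congʳ x̂ (+ˢ-congˡ (D ⟦ p ⟧) (⊛-congˡ ⟦ p ⟧ (κℕ-suc i)))) ⟩
  κℕ i ⊛ κ (ιℤ a) +ˢ x̂ ⊛ (κ[1+ i ] ⊛ ⟦ p ⟧ +ˢ D ⟦ p ⟧)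
    ≈⟨ solve 5 (λ c a x p Dp → c :* a :+ x :* ((con 1ℚ :+ c) :* p :+ Dp) := c :* (a :+ x :* p) :+ (x :* p :+ x :* Dp))
         ≈-refl (κℕ i) (κ (ιℤ a)) x̂ ⟦ p ⟧ (D ⟦ p ⟧) ⟩
  κℕ i ⊛ ⟦ a ∷ p ⟧ +ˢ (x̂ ⊛ ⟦ p ⟧ +ˢ x̂ ⊛ D ⟦ p ⟧)
    ≈⟨ +ˢ-congʳ (κℕ i ⊛ ⟦ a ∷ p ⟧) (D-⟦∷⟧ a p) ⟨
  κℕ i ⊛ ⟦ a ∷ p ⟧ +ˢ D ⟦ a ∷ p ⟧ ∎
  where open ≈-Reasoning

-- Since D x̂ = x̂, the operator x d/dx becomes D.
⟦⟧-mulX-deriv : ∀ p → ⟦ mulX (deriv p) ⟧ ≈ D ⟦ p ⟧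
⟦⟧-mulX-deriv []      = ≈-trans (solve 1 (λ x → con 0ℚ :+ x :* con 0ℚ := con 0ℚ) ≈-refl x̂) (≈-sym (D-κ 0ℚ))
⟦⟧-mulX-deriv (a ∷ p) = begin
  ⟦ mulX (derivFrom 1 p) ⟧                 ≈⟨ ≈-trans (⟦⟧-mulX (derivFrom 1 p)) (⊛-congʳ x̂ (⟦⟧-derivFrom 1 p)) ⟩
  x̂ ⊛ (κℕ 1 ⊛ ⟦ p ⟧ +ˢ D ⟦ p ⟧)            ≈⟨ solve 3 (λ x p Dp → x :* (con 1ℚ :* p :+ Dp) := x :* p :+ x :* Dp)
                                                ≈-refl x̂ ⟦ p ⟧ (D ⟦ p ⟧) ⟩
  x̂ ⊛ ⟦ p ⟧ +ˢ x̂ ⊛ D ⟦ p ⟧                  ≈⟨ D-⟦∷⟧ a p ⟨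
  D ⟦ a ∷ p ⟧                              ∎
  where open ≈-Reasoning

⟦⟧-mulX1-X-deriv : ∀ p → ⟦ mulX1-X (deriv p) ⟧ ≈ (𝟙 -ˢ x̂) ⊛ D ⟦ p ⟧
⟦⟧-mulX1-X-deriv p = begin
  ⟦ mulX p′ ⊕ scale -[1+ 0 ] (mulX (mulX p′)) ⟧
    ≈⟨ ⟦⟧-⊕ (mulX p′) (scale -[1+ 0 ] (mulX (mulX p′))) ⟩
  ⟦ mulX p′ ⟧ +ˢ ⟦ scale -[1+ 0 ] (mulX (mulX p′)) ⟧
    ≈⟨ +ˢ-cong (⟦⟧-mulX-deriv p) (≈-trans (⟦⟧-scale -[1+ 0 ] (mulX (mulX p′)))
         (⊛-congʳ (κ (ℚ.- 1ℚ)) (≈-trans (⟦⟧-mulX (mulX p′)) (⊛-congʳ x̂ (⟦⟧-mulX-deriv p))))) ⟩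
  D ⟦ p ⟧ +ˢ κ (ℚ.- 1ℚ) ⊛ (x̂ ⊛ D ⟦ p ⟧)
    ≈⟨ solve 2 (λ x Dp → Dp :+ con (ℚ.- 1ℚ) :* (x :* Dp) := (con 1ℚ :- x) :* Dp) ≈-refl x̂ (D ⟦ p ⟧) ⟩
  (𝟙 -ˢ x̂) ⊛ D ⟦ p ⟧ ∎
  where
  open ≈-Reasoning
  p′ = deriv p

-- The recurrences for p and q at x = e^t/4; P m and Q m stand for p_{m-1} and q_{m-1}

P : ℕ → Series
P m = ⟦ proj₁ (pq m) ⟧

Q : ℕ → Series
Q m = ⟦ proj₂ (pq m) ⟧

private
  κ[m-1] : ∀ m → κ (ιℤ (+ m ℤ.- + 1)) ≈ κℕ m -ˢ 𝟙
  κ[m-1] m = ≈-trans (κ-cong (trans (ιℤ-+ (+ m) (ℤ.- + 1)) (cong (ι m ℚ.+_) (ιℤ-neg (+ 1)))))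
                     (≈-trans (κ-+ (ι m) (ℚ.- 1ℚ)) (+ˢ-congʳ (κℕ m) (κ-neg 1ℚ)))

  κ[2[m-1+1]] : ∀ m → κ (ιℤ (+ 2 ℤ.* ((+ m ℤ.- + 1) ℤ.+ + 1))) ≈ κℕ 2 ⊛ κℕ m
  κ[2[m-1+1]] m = ≈-trans (κ-cong (trans (cong (λ k → ιℤ (+ 2 ℤ.* k)) (m-1+1≡m (+ m))) (ιℤ-* (+ 2) (+ m))))
                         (κ-* (ι 2) (ι m))
    where
    m-1+1≡m : ∀ m → (m ℤ.- + 1) ℤ.+ + 1 ≡ m
    m-1+1≡m = solve-∀

P-suc : ∀ m → P (suc m) ≈ κℕ 2 ⊛ ((κℕ m -ˢ 𝟙) ⊛ (x̂ ⊛ P m) +ˢ P m) +ˢ κℕ 2 ⊛ ((𝟙 -ˢ x̂) ⊛ D (P m)) +ˢ Q m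
P-suc m = ≈-trans (⟦⟧-⊕ (p₁ ⊕ p₂) q) (+ˢ-congˡ (Q m) (≈-trans (⟦⟧-⊕ p₁ p₂) (+ˢ-cong ⟦p₁⟧ ⟦p₂⟧)))
  where
  p = proj₁ (pq m)
  q = proj₂ (pq m)
  k = + m ℤ.- + 1
  p₁ = scale (+ 2) (scale k (mulX p) ⊕ p)
  p₂ = scale (+ 2) (mulX1-X (deriv p))
  ⟦p₁⟧ : ⟦ p₁ ⟧ ≈ κℕ 2 ⊛ ((κℕ m -ˢ 𝟙) ⊛ (x̂ ⊛ P m) +ˢ P m)
  ⟦p₁⟧ = ≈-trans (⟦⟧-scale (+ 2) (scale k (mulX p) ⊕ p)) (⊛-congʳ (κℕ 2) (≈-trans (⟦⟧-⊕ (scale k (mulX p)) p)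
          (+ˢ-congˡ (P m) (≈-trans (⟦⟧-scale k (mulX p)) (⊛-cong (κ[m-1] m) (⟦⟧-mulX p))))))
  ⟦p₂⟧ : ⟦ p₂ ⟧ ≈ κℕ 2 ⊛ ((𝟙 -ˢ x̂) ⊛ D (P m))
  ⟦p₂⟧ = ≈-trans (⟦⟧-scale (+ 2) (mulX1-X (deriv p))) (⊛-congʳ (κℕ 2) (⟦⟧-mulX1-X-deriv p))

Q-suc : ∀ m → Q (suc m) ≈ (κℕ 2 ⊛ κℕ m) ⊛ (x̂ ⊛ Q m) +ˢ Q m +ˢ κℕ 2 ⊛ ((𝟙 -ˢ x̂) ⊛ D (Q m))
Q-suc m = ≈-trans (⟦⟧-⊕ (scale c (mulX q) ⊕ q) (scale (+ 2) (mulX1-X (deriv q))))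
  (+ˢ-cong (≈-trans (⟦⟧-⊕ (scale c (mulX q)) q) (+ˢ-congˡ (Q m) (≈-trans (⟦⟧-scale c (mulX q))
              (⊛-cong (κ[2[m-1+1]] m) (⟦⟧-mulX q)))))
           (≈-trans (⟦⟧-scale (+ 2) (mulX1-X (deriv q))) (⊛-congʳ (κℕ 2) (⟦⟧-mulX1-X-deriv q))))
  where
  q = proj₂ (pq m)
  c = + 2 ℤ.* ((+ m ℤ.- + 1) ℤ.+ + 1)

*-1/ι!-ι! : ∀ a n → (a ℚ.* 1/ι! n) ℚ.* ι (n !) ≡ a
*-1/ι!-ι! a n = trans (ℚP.*-assoc a (1/ι! n) (ι (n !))) (trans (cong (a ℚ.*_) (1/ι!-inverse n)) (ℚP.*-identityʳ a))

n!/[i![n∸i]!]≡nCi : ∀ n i → i ℕ.≤ n → (1/ι! i ℚ.* 1/ι! (n ℕ.∸ i)) ℚ.* ι (n !) ≡ ι (n C i)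
n!/[i![n∸i]!]≡nCi n i i≤n = begin
  (1/ι! i ℚ.* 1/ι! (n ℕ.∸ i)) ℚ.* ι (n !)
    ≡⟨ cong (λ k → (1/ι! i ℚ.* 1/ι! (n ℕ.∸ i)) ℚ.* ι k) (nCk*k![n∸k]!≡n! i≤n) ⟨
  (1/ι! i ℚ.* 1/ι! (n ℕ.∸ i)) ℚ.* ι ((n C i) ℕ.* (i ! ℕ.* (n ℕ.∸ i) !))
    ≡⟨ cong ((1/ι! i ℚ.* 1/ι! (n ℕ.∸ i)) ℚ.*_) (trans (ι-* (n C i) _) (cong (ι (n C i) ℚ.*_) (ι-* (i !) ((n ℕ.∸ i) !)))) ⟩
  (1/ι! i ℚ.* 1/ι! (n ℕ.∸ i)) ℚ.* (ι (n C i) ℚ.* (ι (i !) ℚ.* ι ((n ℕ.∸ i) !)))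
    ≡⟨ ℚS.solve 5 (λ a b c d e → (a ℚS.:* b) ℚS.:* (c ℚS.:* (d ℚS.:* e)) ℚS.:= c ℚS.:* ((a ℚS.:* d) ℚS.:* (b ℚS.:* e))) refl
         (1/ι! i) (1/ι! (n ℕ.∸ i)) (ι (n C i)) (ι (i !)) (ι ((n ℕ.∸ i) !)) ⟩
  ι (n C i) ℚ.* ((1/ι! i ℚ.* ι (i !)) ℚ.* (1/ι! (n ℕ.∸ i) ℚ.* ι ((n ℕ.∸ i) !)))
    ≡⟨ cong₂ (λ a b → ι (n C i) ℚ.* (a ℚ.* b)) (1/ι!-inverse i) (1/ι!-inverse (n ℕ.∸ i)) ⟩
  ι (n C i) ℚ.* (1ℚ ℚ.* 1ℚ)
    ≡⟨ ℚP.*-identityʳ (ι (n C i)) ⟩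
  ι (n C i) ∎
  where open ≡-Reasoning

Φ : Series
Φ zero    = 0ℚ
Φ (suc n) = A n ℚ.* 1/ι! (suc n)

D-Φ : ∀ n → D Φ n ≡ A n ℚ.* 1/ι! n
D-Φ n = trans (x∙yz≈y∙xz (ι (suc n)) (A n) (1/ι! (suc n))) (cong (A n ℚ.*_) (1/ι!-suc n))

Φ-*-ι! : ∀ n → Φ n ℚ.* ι (n !) ≡ (Z ⊛ A) n
Φ-*-ι! zero    = trans (ℚP.*-zeroˡ (ι 1)) (sym (Z-⊛-zero A))
Φ-*-ι! (suc n) = trans (*-1/ι!-ι! (A n) (suc n)) (sym (Z-⊛-suc A n))

-- The convolution of exponential generating functions is the binomial transform.
x̂-⊛-D-Φ : ∀ n → (x̂ ⊛ D Φ) n ℚ.* ι (n !) ≡ + 1 / 4 ℚ.* T A n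
x̂-⊛-D-Φ n = begin
  (x̂ ⊛ D Φ) n ℚ.* ι (n !)
    ≡⟨ cong (ℚ._* ι (n !)) (⊛-comm x̂ (D Φ) n) ⟩
  Σ≤ n (λ i → D Φ i ℚ.* x̂ (n ℕ.∸ i)) ℚ.* ι (n !)
    ≡⟨ Σ≤-*ʳ n (ι (n !)) _ ⟨
  Σ≤ n (λ i → (D Φ i ℚ.* x̂ (n ℕ.∸ i)) ℚ.* ι (n !))
    ≡⟨ Σ≤-cong-≤ n term ⟩
  Σ≤ n (λ i → + 1 / 4 ℚ.* (ι (n C i) ℚ.* A i))
    ≡⟨ Σ≤-*ˡ n (+ 1 / 4) _ ⟩
  + 1 / 4 ℚ.* T A n ∎
  where
  open ≡-Reasoning
  term : ∀ i → i ℕ.≤ n → (D Φ i ℚ.* x̂ (n ℕ.∸ i)) ℚ.* ι (n !) ≡ + 1 / 4 ℚ.* (ι (n C i) ℚ.* A i)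
  term i i≤n = begin
    (D Φ i ℚ.* x̂ (n ℕ.∸ i)) ℚ.* ι (n !)
      ≡⟨ cong (λ d → (d ℚ.* x̂ (n ℕ.∸ i)) ℚ.* ι (n !)) (D-Φ i) ⟩
    ((A i ℚ.* 1/ι! i) ℚ.* (+ 1 / 4 ℚ.* 1/ι! (n ℕ.∸ i))) ℚ.* ι (n !)
      ≡⟨ ℚS.solve 5 (λ a b q c f → ((a ℚS.:* b) ℚS.:* (q ℚS.:* c)) ℚS.:* f ℚS.:= q ℚS.:* (((b ℚS.:* c) ℚS.:* f) ℚS.:* a))
           refl (A i) (1/ι! i) (+ 1 / 4) (1/ι! (n ℕ.∸ i)) (ι (n !)) ⟩
    + 1 / 4 ℚ.* (((1/ι! i ℚ.* 1/ι! (n ℕ.∸ i)) ℚ.* ι (n !)) ℚ.* A i)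
      ≡⟨ cong (λ c → + 1 / 4 ℚ.* (c ℚ.* A i)) (n!/[i![n∸i]!]≡nCi n i i≤n) ⟩
    + 1 / 4 ℚ.* (ι (n C i) ℚ.* A i) ∎

Φ-ODE : (𝟙 -ˢ x̂) ⊛ D Φ ≈ κℕ 3 ⊛ x̂ +ˢ κ (+ 1 / 2) ⊛ Φ
Φ-ODE n = *-cancelʳ-ι (n !) {{n !≢0}} (begin
  ((𝟙 -ˢ x̂) ⊛ D Φ) n ℚ.* ι (n !)
    ≡⟨ cong (ℚ._* ι (n !)) (solve 2 (λ x d → (con 1ℚ :- x) :* d := d :- x :* d) ≈-refl x̂ (D Φ) n) ⟩
  (D Φ n ℚ.- (x̂ ⊛ D Φ) n) ℚ.* ι (n !)
    ≡⟨ trans (ℚP.*-distribʳ-+ (ι (n !)) (D Φ n) (ℚ.- (x̂ ⊛ D Φ) n))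
             (cong (D Φ n ℚ.* ι (n !) ℚ.+_) (sym (ℚP.neg-distribˡ-* ((x̂ ⊛ D Φ) n) (ι (n !))))) ⟩
  D Φ n ℚ.* ι (n !) ℚ.- (x̂ ⊛ D Φ) n ℚ.* ι (n !)
    ≡⟨ cong₂ ℚ._-_ (trans (cong (ℚ._* ι (n !)) (D-Φ n)) (*-1/ι!-ι! (A n) n)) (x̂-⊛-D-Φ n) ⟩
  A n ℚ.- + 1 / 4 ℚ.* T A n
    ≡⟨ ℚS.solve 3 (λ a b t → a ℚS.:- ℚS.con (+ 1 / 4) ℚS.:* t
                          ℚS.:= ℚS.con (+ 1 / 4) ℚS.:* (ℚS.con (ι 4) ℚS.:* a ℚS.:- ℚS.con (ι 2) ℚS.:* b ℚS.:- t)
                                ℚS.:+ ℚS.con (+ 1 / 2) ℚS.:* b)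
         refl (A n) ((Z ⊛ A) n) (T A n) ⟩
  + 1 / 4 ℚ.* (ι 4 ℚ.* A n ℚ.- ι 2 ℚ.* (Z ⊛ A) n ℚ.- T A n) ℚ.+ + 1 / 2 ℚ.* (Z ⊛ A) n
    ≡⟨ cong (λ r → + 1 / 4 ℚ.* r ℚ.+ + 1 / 2 ℚ.* (Z ⊛ A) n) (A-recurrence n) ⟩
  + 1 / 4 ℚ.* ι 3 ℚ.+ + 1 / 2 ℚ.* (Z ⊛ A) n
    ≡⟨ cong₂ ℚ._+_ (trans (ℚP.*-comm (+ 1 / 4) (ι 3)) (cong (ι 3 ℚ.*_) (sym (*-1/ι!-ι! (+ 1 / 4) n))))
                   (cong (+ 1 / 2 ℚ.*_) (sym (Φ-*-ι! n))) ⟩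
  ι 3 ℚ.* (x̂ n ℚ.* ι (n !)) ℚ.+ + 1 / 2 ℚ.* (Φ n ℚ.* ι (n !))
    ≡⟨ cong₂ ℚ._+_ (ℚP.*-assoc (ι 3) (x̂ n) (ι (n !))) (ℚP.*-assoc (+ 1 / 2) (Φ n) (ι (n !))) ⟨
  ι 3 ℚ.* x̂ n ℚ.* ι (n !) ℚ.+ + 1 / 2 ℚ.* Φ n ℚ.* ι (n !)
    ≡⟨ ℚP.*-distribʳ-+ (ι (n !)) (ι 3 ℚ.* x̂ n) (+ 1 / 2 ℚ.* Φ n) ⟨
  (ι 3 ℚ.* x̂ n ℚ.+ + 1 / 2 ℚ.* Φ n) ℚ.* ι (n !)
    ≡⟨ cong (ℚ._* ι (n !)) (cong₂ ℚ._+_ (κ-⊛ (ι 3) x̂ n) (κ-⊛ (+ 1 / 2) Φ n)) ⟨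
  (κℕ 3 ⊛ x̂ +ˢ κ (+ 1 / 2) ⊛ Φ) n ℚ.* ι (n !) ∎)
  where open ≡-Reasoning

-- Γ m = 3x p_{m-1} + q_{m-1} Φ/2 satisfies 2Γ_m = 2^m (1-x)^m Φ^{(m)}

L : Series
L = 𝟙 -ˢ x̂

D-L : D L ≈ -ˢ x̂
D-L = begin
  D (𝟙 -ˢ x̂)          ≈⟨ D-+ 𝟙 (-ˢ x̂) ⟩
  D 𝟙 +ˢ D (-ˢ x̂)     ≈⟨ +ˢ-cong (D-κ 1ℚ) (≈-trans (D-neg x̂) (-ˢ-cong D-x̂)) ⟩
  κ 0ℚ +ˢ (-ˢ x̂)      ≈⟨ solve 1 (λ x → con 0ℚ :+ (:- x) := :- x) ≈-refl x̂ ⟩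
  -ˢ x̂                ∎
  where open ≈-Reasoning

L^ : ℕ → Series
L^ zero    = 𝟙
L^ (suc m) = L ⊛ L^ m

L-⊛-D-L^ : ∀ m → L ⊛ D (L^ m) ≈ -ˢ (κℕ m ⊛ (x̂ ⊛ L^ m))
L-⊛-D-L^ zero = ≈-trans (⊛-congʳ L (D-κ 1ℚ))
  (solve 1 (λ x → (con 1ℚ :- x) :* con 0ℚ := :- (con (ι 0) :* (x :* con 1ℚ))) ≈-refl x̂)
L-⊛-D-L^ (suc m) = begin
  L ⊛ D (L ⊛ L^ m)
    ≈⟨ ⊛-congʳ L (≈-trans (D-Leibniz L (L^ m)) (+ˢ-congˡ (L ⊛ D (L^ m)) (⊛-congˡ (L^ m) D-L))) ⟩
  L ⊛ ((-ˢ x̂) ⊛ L^ m +ˢ L ⊛ D (L^ m))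
    ≈⟨ ≈-modulo L (L ⊛ D (L^ m) -ˢ (-ˢ (κℕ m ⊛ (x̂ ⊛ L^ m))))
         (solve 4 (λ x R DR M → (con 1ℚ :- x) :* ((:- x) :* R :+ (con 1ℚ :- x) :* DR)
                             := (:- ((con 1ℚ :+ M) :* (x :* ((con 1ℚ :- x) :* R))))
                                :+ (con 1ℚ :- x) :* ((con 1ℚ :- x) :* DR :- (:- (M :* (x :* R)))))
            ≈-refl x̂ (L^ m) (D (L^ m)) (κℕ m))
         (≈⇒difference≈0 (L-⊛-D-L^ m)) ⟩
  -ˢ (κ[1+ m ] ⊛ (x̂ ⊛ (L ⊛ L^ m)))
    ≈⟨ -ˢ-cong (⊛-congˡ (x̂ ⊛ (L ⊛ L^ m)) (κℕ-suc m)) ⟨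
  -ˢ (κℕ (suc m) ⊛ (x̂ ⊛ (L ⊛ L^ m))) ∎
  where open ≈-Reasoning

L^-at-0 : ∀ m → L^ m 0 ≡ (+ 3 / 4) ^ℚ m
L^-at-0 zero    = refl
L^-at-0 (suc m) = cong (+ 3 / 4 ℚ.*_) (L^-at-0 m)

D^ : ℕ → Series → Series
D^ zero    f = f
D^ (suc m) f = D^ m (D f)

D-D^ : ∀ m f → D (D^ m f) ≈ D^ m (D f)
D-D^ zero    f = ≈-refl
D-D^ (suc m) f = D-D^ m (D f)

D^-at-0 : ∀ m f → D^ m f 0 ≡ ι (m !) ℚ.* f m
D^-at-0 zero    f = sym (ℚP.*-identityˡ (f 0))
D^-at-0 (suc m) f = begin
  D^ m (D f) 0                               ≡⟨ D^-at-0 m (D f) ⟩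
  ι (m !) ℚ.* (ι (suc m) ℚ.* f (suc m))      ≡⟨ ℚP.*-assoc (ι (m !)) (ι (suc m)) (f (suc m)) ⟨
  (ι (m !) ℚ.* ι (suc m)) ℚ.* f (suc m)      ≡⟨ cong (ℚ._* f (suc m)) (trans (ℚP.*-comm (ι (m !)) (ι (suc m))) (sym (ι-! m))) ⟩
  ι (suc m !) ℚ.* f (suc m)                  ∎
  where open ≡-Reasoning

N : ℕ → Series
N m = L^ m ⊛ D^ m Φ

N-suc : ∀ m → N (suc m) ≈ L ⊛ D (N m) +ˢ κℕ m ⊛ (x̂ ⊛ N m)
N-suc m = begin
  (L ⊛ L^ m) ⊛ F′
    ≈⟨ ≈-modulo F (L ⊛ D (L^ m) -ˢ (-ˢ (κℕ m ⊛ (x̂ ⊛ L^ m))))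
         (solve 7 (λ L R DR F F′ M x → L :* (DR :* F :+ R :* F′) :+ M :* (x :* (R :* F))
                                    := (L :* R) :* F′ :+ F :* (L :* DR :- (:- (M :* (x :* R)))))
            ≈-refl L (L^ m) (D (L^ m)) F F′ (κℕ m) x̂)
         (≈⇒difference≈0 (L-⊛-D-L^ m)) ⟨
  L ⊛ (D (L^ m) ⊛ F +ˢ L^ m ⊛ F′) +ˢ κℕ m ⊛ (x̂ ⊛ N m)
    ≈⟨ +ˢ-congˡ (κℕ m ⊛ (x̂ ⊛ N m)) (⊛-congʳ L (≈-trans (D-Leibniz (L^ m) F)
         (+ˢ-congʳ (D (L^ m) ⊛ F) (⊛-congʳ (L^ m) (D-D^ m Φ))))) ⟨
  L ⊛ D (N m) +ˢ κℕ m ⊛ (x̂ ⊛ N m) ∎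
  where
  open ≈-Reasoning
  F = D^ m Φ
  F′ = D^ m (D Φ)

Γ : ℕ → Series
Γ m = κℕ 3 ⊛ (x̂ ⊛ P m) +ˢ κ (+ 1 / 2) ⊛ (Q m ⊛ Φ)

D-Γ : ∀ m → D (Γ m) ≈ κℕ 3 ⊛ (x̂ ⊛ P m +ˢ x̂ ⊛ D (P m)) +ˢ κ (+ 1 / 2) ⊛ (D (Q m) ⊛ Φ +ˢ Q m ⊛ D Φ)
D-Γ m = ≈-trans (D-+ (κℕ 3 ⊛ (x̂ ⊛ P m)) (κ (+ 1 / 2) ⊛ (Q m ⊛ Φ)))
  (+ˢ-cong (≈-trans (D-κ-⊛ (ι 3) (x̂ ⊛ P m))
              (⊛-congʳ (κℕ 3) (≈-trans (D-Leibniz x̂ (P m)) (+ˢ-congˡ (x̂ ⊛ D (P m)) (⊛-congˡ (P m) D-x̂)))))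
           (≈-trans (D-κ-⊛ (+ 1 / 2) (Q m ⊛ Φ)) (⊛-congʳ (κ (+ 1 / 2)) (D-Leibniz (Q m) Φ))))

-- The differential equation for Φ is exactly what makes the Φ-terms of Γ match.
Γ-suc : ∀ m → Γ (suc m) ≈ κℕ 2 ⊛ (L ⊛ D (Γ m)) +ˢ κℕ 2 ⊛ (κℕ m ⊛ (x̂ ⊛ Γ m))
Γ-suc m = begin
  Γ (suc m)
    ≈⟨ +ˢ-cong (⊛-congʳ (κℕ 3) (⊛-congʳ x̂ (P-suc m))) (⊛-congʳ (κ (+ 1 / 2)) (⊛-congˡ Φ (Q-suc m))) ⟩
  κℕ 3 ⊛ (x̂ ⊛ P′) +ˢ κ (+ 1 / 2) ⊛ (Q′ ⊛ Φ)
    ≈⟨ ≈-modulo (Q m) (L ⊛ D Φ -ˢ (κℕ 3 ⊛ x̂ +ˢ κ (+ 1 / 2) ⊛ Φ))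
         (solve 8 (λ x P DP Q DQ Φ DΦ M →
            let two = con (ι 2)
                three = con (ι 3)
                half = con (+ 1 / 2)
                L = con 1ℚ :- x
                P′ = two :* ((M :- con 1ℚ) :* (x :* P) :+ P) :+ two :* (L :* DP) :+ Q
                Q′ = (two :* M) :* (x :* Q) :+ Q :+ two :* (L :* DQ)
                DΓ = three :* (x :* P :+ x :* DP) :+ half :* (DQ :* Φ :+ Q :* DΦ)
                Γ = three :* (x :* P) :+ half :* (Q :* Φ)
            in two :* (L :* DΓ) :+ two :* (M :* (x :* Γ))
               := (three :* (x :* P′) :+ half :* (Q′ :* Φ)) :+ Q :* (L :* DΦ :- (three :* x :+ half :* Φ)))
            ≈-refl x̂ (P m) (D (P m)) (Q m) (D (Q m)) Φ (D Φ) (κℕ m))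
         (≈⇒difference≈0 Φ-ODE) ⟨
  κℕ 2 ⊛ (L ⊛ (κℕ 3 ⊛ (x̂ ⊛ P m +ˢ x̂ ⊛ D (P m)) +ˢ κ (+ 1 / 2) ⊛ (D (Q m) ⊛ Φ +ˢ Q m ⊛ D Φ)))
    +ˢ κℕ 2 ⊛ (κℕ m ⊛ (x̂ ⊛ Γ m))
    ≈⟨ +ˢ-congˡ (κℕ 2 ⊛ (κℕ m ⊛ (x̂ ⊛ Γ m))) (⊛-congʳ (κℕ 2) (⊛-congʳ L (D-Γ m))) ⟨
  κℕ 2 ⊛ (L ⊛ D (Γ m)) +ˢ κℕ 2 ⊛ (κℕ m ⊛ (x̂ ⊛ Γ m)) ∎
  where
  open ≈-Reasoning
  P′ = κℕ 2 ⊛ ((κℕ m -ˢ 𝟙) ⊛ (x̂ ⊛ P m) +ˢ P m) +ˢ κℕ 2 ⊛ ((𝟙 -ˢ x̂) ⊛ D (P m)) +ˢ Q m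
  Q′ = (κℕ 2 ⊛ κℕ m) ⊛ (x̂ ⊛ Q m) +ˢ Q m +ˢ κℕ 2 ⊛ ((𝟙 -ˢ x̂) ⊛ D (Q m))

2Γ≈2^mN : ∀ m → κℕ 2 ⊛ Γ m ≈ κ (ι 2 ^ℚ m) ⊛ N m
2Γ≈2^mN zero = solve 2 (λ x Φ → con (ι 2) :* (con (ι 3) :* (x :* con 0ℚ) :+ con (+ 1 / 2) :* ((con 1ℚ :+ x :* con 0ℚ) :* Φ))
                             := con 1ℚ :* (con 1ℚ :* Φ)) ≈-refl x̂ Φ
2Γ≈2^mN (suc m) = begin
  κℕ 2 ⊛ Γ (suc m)
    ≈⟨ ⊛-congʳ (κℕ 2) (Γ-suc m) ⟩
  κℕ 2 ⊛ (κℕ 2 ⊛ (L ⊛ D (Γ m)) +ˢ κℕ 2 ⊛ (κℕ m ⊛ (x̂ ⊛ Γ m)))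
    ≈⟨ solve 5 (λ G L DG M x → con (ι 2) :* (con (ι 2) :* (L :* DG) :+ con (ι 2) :* (M :* (x :* G)))
                            := con (ι 2) :* (L :* (con (ι 2) :* DG) :+ M :* (x :* (con (ι 2) :* G))))
         ≈-refl (Γ m) L (D (Γ m)) (κℕ m) x̂ ⟩
  κℕ 2 ⊛ (L ⊛ (κℕ 2 ⊛ D (Γ m)) +ˢ κℕ m ⊛ (x̂ ⊛ (κℕ 2 ⊛ Γ m)))
    ≈⟨ ⊛-congʳ (κℕ 2) (+ˢ-cong
         (⊛-congʳ L (≈-trans (≈-sym (D-κ-⊛ (ι 2) (Γ m))) (≈-trans (D-cong (2Γ≈2^mN m)) (D-κ-⊛ (ι 2 ^ℚ m) (N m)))))
         (⊛-congʳ (κℕ m) (⊛-congʳ x̂ (2Γ≈2^mN m)))) ⟩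
  κℕ 2 ⊛ (L ⊛ (c ⊛ D (N m)) +ˢ κℕ m ⊛ (x̂ ⊛ (c ⊛ N m)))
    ≈⟨ solve 7 (λ two c L DN M x N → two :* (L :* (c :* DN) :+ M :* (x :* (c :* N)))
                                  := (two :* c) :* (L :* DN :+ M :* (x :* N)))
         ≈-refl (κℕ 2) c L (D (N m)) (κℕ m) x̂ (N m) ⟩
  (κℕ 2 ⊛ c) ⊛ (L ⊛ D (N m) +ˢ κℕ m ⊛ (x̂ ⊛ N m))
    ≈⟨ ⊛-cong (≈-sym (κ-* (ι 2) (ι 2 ^ℚ m))) (≈-sym (N-suc m)) ⟩
  κ (ι 2 ^ℚ suc m) ⊛ N (suc m) ∎
  where
  open ≈-Reasoning
  c = κ (ι 2 ^ℚ m)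

p-at-¼ : ∀ n → + 3 / 2 ℚ.* eval (pPoly n) (+ 1 / 4) ≡ (+ 3 / 2) ^ℚ suc n ℚ.* A n
p-at-¼ n = begin
  + 3 / 2 ℚ.* e
    ≡⟨ ℚS.solve 2 (λ e q → ℚS.con (+ 3 / 2) ℚS.:* e
                         ℚS.:= ℚS.con (ι 2) ℚS.:* (ℚS.con (ι 3) ℚS.:* (ℚS.con (+ 1 / 4) ℚS.:* e)
                                                    ℚS.:+ ℚS.con (+ 1 / 2) ℚS.:* (q ℚS.:* ℚS.con 0ℚ)))
         refl e (Q (suc n) 0) ⟩
  ι 2 ℚ.* (ι 3 ℚ.* (+ 1 / 4 ℚ.* e) ℚ.+ + 1 / 2 ℚ.* (Q (suc n) 0 ℚ.* 0ℚ))
    ≡⟨ cong (λ y → ι 2 ℚ.* (ι 3 ℚ.* (+ 1 / 4 ℚ.* y) ℚ.+ + 1 / 2 ℚ.* (Q (suc n) 0 ℚ.* 0ℚ))) (⟦⟧-at-0 (pPoly n)) ⟨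
  (κℕ 2 ⊛ Γ (suc n)) 0
    ≡⟨ 2Γ≈2^mN (suc n) 0 ⟩
  ι 2 ^ℚ suc n ℚ.* (L^ (suc n) 0 ℚ.* D^ (suc n) Φ 0)
    ≡⟨ cong₂ (λ a b → ι 2 ^ℚ suc n ℚ.* (a ℚ.* b)) (L^-at-0 (suc n)) D^Φ-at-0 ⟩
  ι 2 ^ℚ suc n ℚ.* ((+ 3 / 4) ^ℚ suc n ℚ.* A n)
    ≡⟨ ℚP.*-assoc (ι 2 ^ℚ suc n) ((+ 3 / 4) ^ℚ suc n) (A n) ⟨
  (ι 2 ^ℚ suc n ℚ.* (+ 3 / 4) ^ℚ suc n) ℚ.* A n
    ≡⟨ cong (ℚ._* A n) (^ℚ-distribʳ-* (ι 2) (+ 3 / 4) (suc n)) ⟨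
  (+ 3 / 2) ^ℚ suc n ℚ.* A n ∎
  where
  open ≡-Reasoning
  e = eval (pPoly n) (+ 1 / 4)
  D^Φ-at-0 : D^ (suc n) Φ 0 ≡ A n
  D^Φ-at-0 = begin
    D^ (suc n) Φ 0                ≡⟨ D^-at-0 (suc n) Φ ⟩
    ι (suc n !) ℚ.* Φ (suc n)     ≡⟨ ℚP.*-comm (ι (suc n !)) (Φ (suc n)) ⟩
    Φ (suc n) ℚ.* ι (suc n !)     ≡⟨ Φ-*-ι! (suc n) ⟩
    (Z ⊛ A) (suc n)               ≡⟨ Z-⊛-suc A n ⟩
    A n                           ∎

mainTheorem6 : (n : ℕ) →
    ((+ 2 / 3) ^ℚ n) ℚ.* eval (pPoly n) (+ 1 / 4)
      ≡ Σ≤ n (λ k → polyBernoulliNeg (n ℕ.∸ k) k)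
mainTheorem6 n = begin
  (+ 2 / 3) ^ℚ n ℚ.* e
    ≡⟨ ℚS.solve 2 (λ a e → a ℚS.:* e ℚS.:= (ℚS.con (+ 2 / 3) ℚS.:* a) ℚS.:* (ℚS.con (+ 3 / 2) ℚS.:* e))
         refl ((+ 2 / 3) ^ℚ n) e ⟩
  (+ 2 / 3) ^ℚ suc n ℚ.* (+ 3 / 2 ℚ.* e)
    ≡⟨ cong ((+ 2 / 3) ^ℚ suc n ℚ.*_) (p-at-¼ n) ⟩
  (+ 2 / 3) ^ℚ suc n ℚ.* ((+ 3 / 2) ^ℚ suc n ℚ.* A n)
    ≡⟨ ℚP.*-assoc ((+ 2 / 3) ^ℚ suc n) ((+ 3 / 2) ^ℚ suc n) (A n) ⟨
  ((+ 2 / 3) ^ℚ suc n ℚ.* (+ 3 / 2) ^ℚ suc n) ℚ.* A n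
    ≡⟨ cong (ℚ._* A n) (trans (sym (^ℚ-distribʳ-* (+ 2 / 3) (+ 3 / 2) (suc n))) (1^ℚn≡1 (suc n))) ⟩
  1ℚ ℚ.* A n
    ≡⟨ ℚP.*-identityˡ (A n) ⟩
  A n
    ≡⟨ rhs≡A n ⟨
  Σ≤ n (λ k → polyBernoulliNeg (n ℕ.∸ k) k) ∎
  where
  open ≡-Reasoning
  e = eval (pPoly n) (+ 1 / 4)
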